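{- Let $X$ be a geometric distance-regular graph of diameter $d\geq 2$ with a Delsarte clique geometry $\mathcal C$. (1) If $\psi_1=1$, then $X$ contains an induced subgraph isomorphic to $K_{\tau_2,2}$. (2) If $\mu\geq 2$, then $X$ contains an induced $K_{2,2}$ (a quadrangle).
   Context: A connected graph of diameter $d$ is distance-regular if for each $0\le i\le d$ there are constants $a_i,b_i,c_i$ such that for any vertices $v,w$ at distance $i$, $w$ has exactly $c_i$, $a_i$, $b_i$ neighbors at distance $i-1$, $i$, $i+1$ from $v$; $k=b_0$, $\mu=c_2$. A Delsarte clique is a clique of size $1-k/\theta_{\min}$ ($\theta_{\min}$ the smallest eigenvalue); a Delsarte clique geometry is a collection $\mathcal C$ of Delsarte cliques such that every edge lies in exactly one member; $X$ is geometric if one exists. For $C\in\mathcal C$ and a vertex $x$ with $\mathrm{dist}(x,C)=i$, the number of $y\in C$ with $\mathrm{dist}(x,y)=i$ depends only on $i$ and is denoted $\psi_i$. For vertices $x,y$ with $\mathrm{dist}(x,y)=i$, the number of $C\in\mathcal C$ with $x\in C$ and $\mathrm{dist}(y,C)=i-1$ depends only on $i$ and is denoted $\tau_i$. -}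

module Defs where

open import Data.Nat using (ℕ; zero; suc; _+_; _≤_; _∸_)
open import Data.Fin using (Fin; zero; suc; _≟_)
open import Data.Bool using (Bool; true; false; _∧_; _∨_; not; if_then_else_)
open import Data.Sum using (_⊎_; inj₁; inj₂)
open import Data.Product using (Σ; ∃; _×_)
open import Data.Integer using (+_)
open import Data.Rational using (ℚ; 0ℚ; _/_) renaming (_+_ to _+ℚ_; _*_ to _*ℚ_; _-_ to _-ℚ_; _≤_ to _≤ℚ_)
open import Relation.Binary.PropositionalEquality using (_≡_; _≢_)
open import Relation.Nullary.Decidable using (⌊_⌋)
open import Function.Definitions using (Injective)

ℕtoℚ : ℕ → ℚ
ℕtoℚ k = (+ k) / 1

anyFin : ∀ {n} → (Fin n → Bool) → Bool
anyFin {zero} p = false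
anyFin {suc n} p = p zero ∨ anyFin (λ i → p (suc i))

count : ∀ {n} → (Fin n → Bool) → ℕ
count {zero} p = 0
count {suc n} p = (if p zero then 1 else 0) + count (λ i → p (suc i))

sumℚ : ∀ {n} → (Fin n → ℚ) → ℚ
sumℚ {zero} f = 0ℚ
sumℚ {suc n} f = f zero +ℚ sumℚ (λ i → f (suc i))

record Graph (n : ℕ) : Set where
  field
    adj    : Fin n → Fin n → Bool
    adj-sym    : ∀ x y → adj x y ≡ adj y x
    adj-irrefl : ∀ x → adj x x ≡ false
open Graph public

within : ∀ {n} → Graph n → ℕ → Fin n → Fin n → Bool
within G zero x y = ⌊ x ≟ y ⌋
within G (suc k) x y = within G k x y ∨ anyFin (λ z → adj G x z ∧ within G k z y)

distIs : ∀ {n} → Graph n → ℕ → Fin n → Fin n → Bool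
distIs G zero x y = within G zero x y
distIs G (suc i) x y = within G (suc i) x y ∧ not (within G i x y)

withinSet : ∀ {n} → Graph n → ℕ → Fin n → (Fin n → Bool) → Bool
withinSet G k x C = anyFin (λ y → C y ∧ within G k x y)

distSetIs : ∀ {n} → Graph n → ℕ → Fin n → (Fin n → Bool) → Bool
distSetIs G zero x C = withinSet G zero x C
distSetIs G (suc i) x C = withinSet G (suc i) x C ∧ not (withinSet G i x C)

record IsDRG {n : ℕ} (G : Graph n) (d : ℕ) (a b c : ℕ → ℕ) : Set where
  field
    connected-diam : ∀ x y → within G d x y ≡ true
    diam-attained  : ∃ λ x → ∃ λ y → distIs G d x y ≡ true
    a-prop : ∀ i → i ≤ d → ∀ v w → distIs G i v w ≡ true →
             count (λ u → adj G w u ∧ distIs G i v u) ≡ a i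
    b-prop : ∀ i → i ≤ d → ∀ v w → distIs G i v w ≡ true →
             count (λ u → adj G w u ∧ distIs G (suc i) v u) ≡ b i
    c-prop : ∀ i → 1 ≤ i → i ≤ d → ∀ v w → distIs G i v w ≡ true →
             count (λ u → adj G w u ∧ distIs G (i ∸ 1) v u) ≡ c i

applyA : ∀ {n} → Graph n → (Fin n → ℚ) → Fin n → ℚ
applyA G v x = sumℚ (λ y → if adj G x y then v y else 0ℚ)

IsEigenvalue : ∀ {n} → Graph n → ℚ → Set
IsEigenvalue {n} G θ = Σ (Fin n → ℚ) λ v →
  (∃ λ x → v x ≢ 0ℚ) × (∀ x → applyA G v x ≡ θ *ℚ v x)

-- θ is the smallest eigenvalue of the adjacency matrix A:
-- θ is an eigenvalue and A - θI is positive semidefinite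
IsSmallestEigenvalue : ∀ {n} → Graph n → ℚ → Set
IsSmallestEigenvalue {n} G θ = IsEigenvalue G θ ×
  (∀ (v : Fin n → ℚ) → 0ℚ ≤ℚ sumℚ (λ x → v x *ℚ (applyA G v x -ℚ θ *ℚ v x)))

IsClique : ∀ {n} → Graph n → (Fin n → Bool) → Set
IsClique G C = ∀ x y → C x ≡ true → C y ≡ true → x ≢ y → adj G x y ≡ true

-- C is a Delsarte clique: clique with |C| = 1 - k/θ, written as |C|·θ = θ - k
IsDelsarteClique : ∀ {n} → Graph n → (k : ℕ) → (θ : ℚ) → (Fin n → Bool) → Set
IsDelsarteClique G k θ C =
  IsClique G C × (ℕtoℚ (count C) *ℚ θ ≡ θ -ℚ ℕtoℚ k)

IsDelsarteCliqueGeometry : ∀ {n} → Graph n → (k : ℕ) → (θ : ℚ) →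
  (m : ℕ) → (Fin m → Fin n → Bool) → Set
IsDelsarteCliqueGeometry G k θ m 𝒞 =
  (∀ j → IsDelsarteClique G k θ (𝒞 j)) ×
  (∀ x y → adj G x y ≡ true → count (λ j → 𝒞 j x ∧ 𝒞 j y) ≡ 1)

Psi1IsOne : ∀ {n m} → Graph n → (Fin m → Fin n → Bool) → Set
Psi1IsOne {n} {m} G 𝒞 = ∀ (j : Fin m) (x : Fin n) → distSetIs G 1 x (𝒞 j) ≡ true →
  count (λ y → 𝒞 j y ∧ distIs G 1 x y) ≡ 1

tauAt : ∀ {n m} → Graph n → (Fin m → Fin n → Bool) → ℕ → Fin n → Fin n → ℕ
tauAt G 𝒞 i x y = count (λ j → 𝒞 j x ∧ distSetIs G (i ∸ 1) y (𝒞 j))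

KAdj : ∀ {p q} → Fin p ⊎ Fin q → Fin p ⊎ Fin q → Bool
KAdj (inj₁ _) (inj₁ _) = false
KAdj (inj₁ _) (inj₂ _) = true
KAdj (inj₂ _) (inj₁ _) = true
KAdj (inj₂ _) (inj₂ _) = false

HasInducedK : ∀ {n} → Graph n → ℕ → ℕ → Set
HasInducedK {n} G p q = Σ (Fin p ⊎ Fin q → Fin n) λ h →
  Injective _≡_ _≡_ h × (∀ u v → adj G (h u) (h v) ≡ KAdj u v)

module Submission where

-- Part (1) is combinatorics of clique geometries (module CliqueGeometry): for x,
-- y at distance 2, the unique neighbours of y in the τ₂ cliques through x at
-- distance 1 from y are distinct and pairwise non-adjacent.
--
-- Part (2) rests on ψ₁ being well defined, which is spectral:
--  * for a Delsarte geometry, Σ_C (Σ_{c∈C} φ c)² = ⟨φ, (A - θ)φ⟩, so every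
--    θ-eigenvector sums to zero over each clique (module DelsarteGeometry);
--  * in a distance-regular graph the spherical function u ↦ α_{dist(v,u)},
--    built from the standard sequence α of θ, is a θ-eigenvector (module
--    DistanceRegular);
--  * summing it over C gives P·α₁ + (|C| - P)·α₂ = 0 with α₁ ≠ α₂, which
--    determines the number P of neighbours in C (module Geometric).
-- Without an induced quadrangle, the common neighbours of two vertices x, y at
-- distance 2 then lie both in the clique through x, u₁ and in the clique
-- through y, u₁, so the two cliques coincide and x ~ y, a contradiction.

open import Defs
open import Data.Nat using (ℕ; zero; suc; _≤_; _<_; z≤n; s≤s; _∸_)
import Data.Nat as ℕ
import Data.Nat.Properties as ℕP
open import Data.Fin using (Fin; zero; suc; _≟_)
open import Data.Fin.Properties using (suc-injective)
open import Data.Bool using (Bool; true; false; _∧_; _∨_; not; if_then_else_)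
open import Data.Bool.Properties using (∧-conicalˡ; ∧-conicalʳ; ∧-zeroʳ; ∧-identityʳ; ∧-idem)
open import Data.Sum using (_⊎_; inj₁; inj₂)
open import Data.Product using (Σ; ∃; _×_; _,_; proj₁; proj₂)
open import Data.Empty using (⊥; ⊥-elim)
open import Data.Integer using (+_)
import Data.Integer as ℤ
import Data.Integer.Properties as ℤP
open import Data.Rational using (ℚ; mkℚ; 0ℚ; 1ℚ; toℚᵘ)
import Data.Rational as Q
import Data.Rational.Properties as QP
import Data.Rational.Unnormalised as U
import Data.Rational.Unnormalised.Properties as UP
open import Data.Rational.Solver using (module +-*-Solver)
open import Data.Nat.Coprimality using (1-coprimeTo) renaming (sym to coprime-sym)
open import Algebra.Bundles using (module Ring)
open import Algebra.Properties.Semiring.Sum (Ring.semiring QP.+-*-ring) using (sum; ∑-distrib-+; ∑-comm; *-distribˡ-sum; sum-replicate-zero)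
open import Relation.Binary.PropositionalEquality
open import Relation.Binary.Definitions using (tri<; tri≈; tri>)
open import Relation.Nullary using (yes; no; ¬_)
open import Relation.Nullary.Decidable using (⌊_⌋)
open import Function.Definitions using (Injective)

open +-*-Solver

∨-true⁻ : ∀ {p q} → p ∨ q ≡ true → p ≡ true ⊎ q ≡ true
∨-true⁻ {true} _ = inj₁ refl
∨-true⁻ {false} e = inj₂ e

∨-trueˡ : ∀ {p} q → p ≡ true → p ∨ q ≡ true
∨-trueˡ q refl = refl

∨-trueʳ : ∀ p {q} → q ≡ true → p ∨ q ≡ true
∨-trueʳ true _ = refl
∨-trueʳ false e = e

∧-true⁻ : ∀ {p q} → p ∧ q ≡ true → p ≡ true × q ≡ true
∧-true⁻ {p} {q} e = ∧-conicalˡ p q e , ∧-conicalʳ p q e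

∧-true : ∀ {p q} → p ≡ true → q ≡ true → p ∧ q ≡ true
∧-true refl refl = refl

not-true⁻ : ∀ {p} → not p ≡ true → p ≡ false
not-true⁻ {false} _ = refl

not-true : ∀ {p} → p ≡ false → not p ≡ true
not-true refl = refl

true≢false : ∀ {p} → p ≡ true → p ≡ false → ⊥
true≢false refl ()

¬true⇒false : ∀ {p} → ¬ (p ≡ true) → p ≡ false
¬true⇒false {true} h = ⊥-elim (h refl)
¬true⇒false {false} _ = refl

¬false⇒true : ∀ {p} → ¬ (p ≡ false) → p ≡ true
¬false⇒true {true} _ = refl
¬false⇒true {false} h = ⊥-elim (h refl)

bool-cases : ∀ {ℓ} {A : Set ℓ} (p : Bool) → (p ≡ true → A) → (p ≡ false → A) → A
bool-cases true f _ = f refl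
bool-cases false _ g = g refl

≟-true⁻ : ∀ {n} {x y : Fin n} → ⌊ x ≟ y ⌋ ≡ true → x ≡ y
≟-true⁻ {x = x} {y} e with x ≟ y
... | yes x≡y = x≡y
... | no _ = ⊥-elim (true≢false e refl)

≟-refl : ∀ {n} (x : Fin n) → ⌊ x ≟ x ⌋ ≡ true
≟-refl x with x ≟ x
... | yes _ = refl
... | no x≢x = ⊥-elim (x≢x refl)

≟-false : ∀ {n} {x y : Fin n} → ¬ (x ≡ y) → ⌊ x ≟ y ⌋ ≡ false
≟-false {x = x} {y} x≢y with x ≟ y
... | yes x≡y = ⊥-elim (x≢y x≡y)
... | no _ = refl

anyFin-witness : ∀ {n} (p : Fin n → Bool) → anyFin p ≡ true → ∃ λ i → p i ≡ true
anyFin-witness {suc n} p e with ∨-true⁻ {p zero} e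
... | inj₁ h = zero , h
... | inj₂ h with anyFin-witness (λ i → p (suc i)) h
...   | i , hi = suc i , hi

anyFin-intro : ∀ {n} (p : Fin n → Bool) i → p i ≡ true → anyFin p ≡ true
anyFin-intro p zero h = ∨-trueˡ _ h
anyFin-intro p (suc i) h = ∨-trueʳ (p zero) (anyFin-intro (λ j → p (suc j)) i h)

anyFin-at : ∀ {n} (f : Fin n → Bool) (y : Fin n) → anyFin (λ z → f z ∧ ⌊ z ≟ y ⌋) ≡ f y
anyFin-at f y with f y in fy
... | true = anyFin-intro _ y (∧-true fy (≟-refl y))
... | false = ¬true⇒false λ h → no-witness (anyFin-witness _ h)
  where
  no-witness : (∃ λ z → (f z ∧ ⌊ z ≟ y ⌋) ≡ true) → ⊥
  no-witness (z , hz) with ∧-true⁻ {f z} hz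
  ... | fz , z≟y with ≟-true⁻ {x = z} z≟y
  ...   | refl = true≢false fz fy

search-pairs : ∀ {n} (q : Fin n → Fin n → Bool) →
  (Σ (Fin n) λ u → Σ (Fin n) λ w → q u w ≡ true) ⊎ (∀ u w → q u w ≡ false)
search-pairs q with anyFin (λ u → anyFin (q u)) in found
... | true with anyFin-witness _ found
...   | u , hu = inj₁ (u , anyFin-witness (q u) hu)
search-pairs q | false = inj₂ λ u w → ¬true⇒false λ quw →
  true≢false (anyFin-intro _ u (anyFin-intro (q u) w quw)) found

count-cong : ∀ {n} {p q : Fin n → Bool} → (∀ i → p i ≡ q i) → count p ≡ count q
count-cong {zero} _ = refl
count-cong {suc n} h rewrite h zero = cong (_ ℕ.+_) (count-cong (λ i → h (suc i)))

count-none : ∀ {n} (p : Fin n → Bool) → (∀ i → p i ≡ false) → count p ≡ 0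
count-none {zero} _ _ = refl
count-none {suc n} p h rewrite h zero = count-none (λ i → p (suc i)) (λ i → h (suc i))

count-witness : ∀ {n} (p : Fin n → Bool) → 1 ≤ count p → ∃ λ i → p i ≡ true
count-witness {suc n} p h with p zero in p0
... | true = zero , p0
... | false with count-witness (λ i → p (suc i)) h
...   | i , hi = suc i , hi

count-positive : ∀ {n} (p : Fin n → Bool) i → p i ≡ true → 1 ≤ count p
count-positive p zero h rewrite h = s≤s z≤n
count-positive p (suc i) h with p zero
... | true = s≤s z≤n
... | false = count-positive (λ j → p (suc j)) i h

count-mono : ∀ {n} (p q : Fin n → Bool) → (∀ i → p i ≡ true → q i ≡ true) → count p ≤ count q
count-mono {zero} _ _ _ = z≤n
count-mono {suc n} p q h with p zero in p0 | q zero in q0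
... | true | true = s≤s (count-mono _ _ (λ i → h (suc i)))
... | true | false = ⊥-elim (true≢false (h zero p0) q0)
... | false | true = ℕP.m≤n⇒m≤1+n (count-mono _ _ (λ i → h (suc i)))
... | false | false = count-mono _ _ (λ i → h (suc i))

count-mono-< : ∀ {n} (p q : Fin n → Bool) → (∀ i → p i ≡ true → q i ≡ true) →
  ∀ x → p x ≡ false → q x ≡ true → count p < count q
count-mono-< p q h zero px qx rewrite px | qx = s≤s (count-mono _ _ (λ i → h (suc i)))
count-mono-< p q h (suc x) px qx with p zero in p0 | q zero in q0
... | true | true = s≤s (count-mono-< _ _ (λ i → h (suc i)) x px qx)
... | true | false = ⊥-elim (true≢false (h zero p0) q0)
... | false | true = ℕP.m≤n⇒m≤1+n (count-mono-< _ _ (λ i → h (suc i)) x px qx)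
... | false | false = count-mono-< _ _ (λ i → h (suc i)) x px qx

count-unique : ∀ {n} (p : Fin n → Bool) → count p ≡ 1 →
  ∀ i j → p i ≡ true → p j ≡ true → i ≡ j
count-unique p e zero zero _ _ = refl
count-unique p e zero (suc j) pi pj rewrite pi =
  ⊥-elim (ℕP.<⇒≢ (count-positive _ j pj) (sym (ℕP.suc-injective e)))
count-unique p e (suc i) zero pi pj rewrite pj =
  ⊥-elim (ℕP.<⇒≢ (count-positive _ i pi) (sym (ℕP.suc-injective e)))
count-unique p e (suc i) (suc j) pi pj with p zero
... | true = ⊥-elim (ℕP.<⇒≢ (count-positive _ i pi) (sym (ℕP.suc-injective e)))
... | false = cong suc (count-unique (λ k → p (suc k)) e i j pi pj)

count-split : ∀ {n} (p q : Fin n → Bool) →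
  count p ≡ count (λ i → p i ∧ q i) ℕ.+ count (λ i → p i ∧ not (q i))
count-split {zero} _ _ = refl
count-split {suc n} p q with p zero | q zero
... | true | true = cong suc (count-split (λ i → p (suc i)) (λ i → q (suc i)))
... | true | false = trans (cong suc (count-split (λ i → p (suc i)) (λ i → q (suc i))))
                          (sym (ℕP.+-suc _ _))
... | false | _ = count-split (λ i → p (suc i)) (λ i → q (suc i))

enumerate : ∀ {n} (p : Fin n → Bool) → Fin (count p) → Fin n
enumerate {suc n} p i with p zero
enumerate {suc n} p zero | true = zero
enumerate {suc n} p (suc i) | true = suc (enumerate (λ j → p (suc j)) i)
enumerate {suc n} p i | false = suc (enumerate (λ j → p (suc j)) i)

enumerate-sound : ∀ {n} (p : Fin n → Bool) i → p (enumerate p i) ≡ true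
enumerate-sound {suc n} p i with p zero in p0
enumerate-sound {suc n} p zero | true = p0
enumerate-sound {suc n} p (suc i) | true = enumerate-sound (λ j → p (suc j)) i
enumerate-sound {suc n} p i | false = enumerate-sound (λ j → p (suc j)) i

enumerate-injective : ∀ {n} (p : Fin n → Bool) → Injective _≡_ _≡_ (enumerate p)
enumerate-injective {suc n} p {i} {j} e with p zero
enumerate-injective {suc n} p {zero} {zero} e | true = refl
enumerate-injective {suc n} p {suc i} {suc j} e | true =
  cong suc (enumerate-injective _ (suc-injective e))
enumerate-injective {suc n} p {i} {j} e | false = enumerate-injective _ (suc-injective e)

two-witnesses : ∀ {n} (p : Fin n → Bool) → 2 ≤ count p →
  Σ (Fin n) λ u → Σ (Fin n) λ w → ¬ (u ≡ w) × p u ≡ true × p w ≡ true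
two-witnesses p = pick (enumerate p) (enumerate-sound p) (enumerate-injective p)
  where
  pick : ∀ {k} (f : Fin k → Fin _) → (∀ i → p (f i) ≡ true) → Injective _≡_ _≡_ f → 2 ≤ k →
    Σ (Fin _) λ u → Σ (Fin _) λ w → ¬ (u ≡ w) × p u ≡ true × p w ≡ true
  pick f sound inj (s≤s (s≤s _)) = f zero , f (suc zero) , (λ e → 0≢1 (inj e)) , sound zero , sound (suc zero)
    where
    0≢1 : ∀ {k} → ¬ (Fin.zero {suc k} ≡ suc zero)
    0≢1 ()

least : (ℕ → Bool) → ℕ → ℕ
least P zero = zero
least P (suc N) = if P zero then zero else suc (least (λ i → P (suc i)) N)

least-sound : ∀ (P : ℕ → Bool) N → P N ≡ true → P (least P N) ≡ true
least-sound P zero h = h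
least-sound P (suc N) h with P zero in P0
... | true = P0
... | false = least-sound (λ i → P (suc i)) N h

least-minimal : ∀ (P : ℕ → Bool) N j → j < least P N → P j ≡ false
least-minimal P (suc N) j j< with P zero in P0
least-minimal P (suc N) zero _ | false = P0
least-minimal P (suc N) (suc j) (s≤s j<) | false = least-minimal (λ i → P (suc i)) N j j<

ℕtoℚ-as-mkℚ : ∀ k → ℕtoℚ k ≡ mkℚ (+ k) 0 (coprime-sym (1-coprimeTo k))
ℕtoℚ-as-mkℚ k = QP.normalize-coprime (coprime-sym (1-coprimeTo k))

ℕtoℚ-suc : ∀ k → ℕtoℚ (suc k) ≡ 1ℚ Q.+ ℕtoℚ k
ℕtoℚ-suc k = QP.toℚᵘ-injective
  (UP.≃-trans (QP.toℚᵘ-cong (ℕtoℚ-as-mkℚ (suc k)))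
  (UP.≃-trans unnormalised (UP.≃-sym (QP.toℚᵘ-homo-+ 1ℚ (ℕtoℚ k)))))
  where
  unnormalised : toℚᵘ (mkℚ (+ suc k) 0 (coprime-sym (1-coprimeTo (suc k))))
                 U.≃ (toℚᵘ 1ℚ U.+ toℚᵘ (ℕtoℚ k))
  unnormalised rewrite ℕtoℚ-as-mkℚ k = U.*≡* (trans (ℤP.*-identityʳ (+ suc k))
    (sym (trans (ℤP.*-identityʳ _)
    (cong₂ ℤ._+_ (ℤP.*-identityʳ (+ 1)) (ℤP.*-identityʳ (+ k))))))

ℕtoℚ-+ : ∀ m n → ℕtoℚ (m ℕ.+ n) ≡ ℕtoℚ m Q.+ ℕtoℚ n
ℕtoℚ-+ zero n = sym (QP.+-identityˡ _)
ℕtoℚ-+ (suc m) n = begin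
  ℕtoℚ (suc (m ℕ.+ n))          ≡⟨ ℕtoℚ-suc (m ℕ.+ n) ⟩
  1ℚ Q.+ ℕtoℚ (m ℕ.+ n)         ≡⟨ cong (1ℚ Q.+_) (ℕtoℚ-+ m n) ⟩
  1ℚ Q.+ (ℕtoℚ m Q.+ ℕtoℚ n)    ≡⟨ sym (QP.+-assoc 1ℚ (ℕtoℚ m) (ℕtoℚ n)) ⟩
  (1ℚ Q.+ ℕtoℚ m) Q.+ ℕtoℚ n    ≡⟨ cong (Q._+ ℕtoℚ n) (sym (ℕtoℚ-suc m)) ⟩
  ℕtoℚ (suc m) Q.+ ℕtoℚ n       ∎
  where open ≡-Reasoning

ℕtoℚ-injective : ∀ {m n} → ℕtoℚ m ≡ ℕtoℚ n → m ≡ n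
ℕtoℚ-injective {m} {n} e =
  ℤP.+-injective (cong ℚ.numerator (trans (sym (ℕtoℚ-as-mkℚ m)) (trans e (ℕtoℚ-as-mkℚ n))))

ℕtoℚ-positive : ∀ {m} → 1 ≤ m → ¬ (ℕtoℚ m ≡ 0ℚ)
ℕtoℚ-positive {suc m} _ e with ℕtoℚ-injective {suc m} {0} e
... | ()

-- Division by a natural number, made total by declaring q ÷ℕ 0 = 0.
_÷ℕ_ : ℚ → ℕ → ℚ
q ÷ℕ zero = 0ℚ
q ÷ℕ suc m = (q Q.÷ ℕtoℚ (suc m)) {{Q.≢-nonZero (ℕtoℚ-positive {suc m} (s≤s z≤n))}}

÷ℕ-cancel : ∀ q m → 1 ≤ m → ℕtoℚ m Q.* (q ÷ℕ m) ≡ q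
÷ℕ-cancel q (suc m) m≥1 = begin
  N Q.* (q Q.* N⁻¹)   ≡⟨ solve 3 (λ n q i → n :* (q :* i) := q :* (n :* i)) refl N q N⁻¹ ⟩
  q Q.* (N Q.* N⁻¹)   ≡⟨ cong (q Q.*_) (QP.*-inverseʳ N {{N≢0}}) ⟩
  q Q.* 1ℚ            ≡⟨ QP.*-identityʳ q ⟩
  q                   ∎
  where
  open ≡-Reasoning
  N = ℕtoℚ (suc m)
  N≢0 = Q.≢-nonZero (ℕtoℚ-positive {suc m} m≥1)
  N⁻¹ = (Q.1/ N) {{N≢0}}

*-zero⁻ : ∀ p q → p Q.* q ≡ 0ℚ → p ≡ 0ℚ ⊎ q ≡ 0ℚ
*-zero⁻ p q pq≡0 with p QP.≟ 0ℚ
... | yes p≡0 = inj₁ p≡0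
... | no p≢0 = inj₂ (begin
    q                   ≡⟨ solve 3 (λ q i p → q := (i :* p) :* q :+ (con 1ℚ :- i :* p) :* q) refl q p⁻¹ p ⟩
    (p⁻¹ Q.* p) Q.* q Q.+ (1ℚ Q.- p⁻¹ Q.* p) Q.* q
      ≡⟨ cong₂ (λ s t → s Q.+ (1ℚ Q.- t) Q.* q) (QP.*-assoc p⁻¹ p q) (QP.*-inverseˡ p {{p≠0}}) ⟩
    p⁻¹ Q.* (p Q.* q) Q.+ (1ℚ Q.- 1ℚ) Q.* q
      ≡⟨ cong (λ s → p⁻¹ Q.* s Q.+ (1ℚ Q.- 1ℚ) Q.* q) pq≡0 ⟩
    p⁻¹ Q.* 0ℚ Q.+ (1ℚ Q.- 1ℚ) Q.* q
      ≡⟨ solve 2 (λ i q → i :* con 0ℚ :+ (con 1ℚ :- con 1ℚ) :* q := con 0ℚ) refl p⁻¹ q ⟩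
    0ℚ                  ∎)
  where
  open ≡-Reasoning
  p≠0 = Q.≢-nonZero p≢0
  p⁻¹ = (Q.1/ p) {{p≠0}}

*-zero-cancelˡ : ∀ p q → p Q.* q ≡ 0ℚ → ¬ (p ≡ 0ℚ) → q ≡ 0ℚ
*-zero-cancelˡ p q pq≡0 p≢0 with *-zero⁻ p q pq≡0
... | inj₁ p≡0 = ⊥-elim (p≢0 p≡0)
... | inj₂ q≡0 = q≡0

square-nonneg : ∀ q → 0ℚ Q.≤ q Q.* q
square-nonneg q with QP.≤-total 0ℚ q
... | inj₁ q≥0 = QP.nonNegative⁻¹ _
      {{QP.nonNeg*nonNeg⇒nonNeg q {{Q.nonNegative q≥0}} q {{Q.nonNegative q≥0}}}}
... | inj₂ q≤0 = QP.nonNegative⁻¹ _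
      {{QP.nonPos*nonPos⇒nonPos q {{Q.nonPositive q≤0}} q {{Q.nonPositive q≤0}}}}

square-zero : ∀ q → q Q.* q ≡ 0ℚ → q ≡ 0ℚ
square-zero q qq≡0 with *-zero⁻ q q qq≡0
... | inj₁ q≡0 = q≡0
... | inj₂ q≡0 = q≡0

difference-form : ∀ A A' x y → A Q.* x Q.+ A' Q.* y ≡ 0ℚ → A Q.* (x Q.- y) ≡ 0ℚ Q.- (A Q.+ A') Q.* y
difference-form A A' x y rel =
  trans (solve 4 (λ a a' x y → a :* (x :- y) := (a :* x :+ a' :* y) :- (a :+ a') :* y) refl A A' x y)
        (cong (Q._- (A Q.+ A') Q.* y) rel)

difference-zero : ∀ p q → p Q.- q ≡ 0ℚ → p ≡ q
difference-zero p q p-q≡0 = trans (solve 2 (λ p q → p := (p :- q) :+ q) refl p q)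
                                  (trans (cong (Q._+ q) p-q≡0) (QP.+-identityˡ q))

coefficient-unique : ∀ P P' Z Z' x y → P Q.+ P' ≡ Z Q.+ Z' →
  P Q.* x Q.+ P' Q.* y ≡ 0ℚ → Z Q.* x Q.+ Z' Q.* y ≡ 0ℚ → ¬ (x ≡ y) → P ≡ Z
coefficient-unique P P' Z Z' x y same-sum P-rel Z-rel x≢y = conclude (*-zero⁻ (P Q.- Z) (x Q.- y) product-zero)
  where
  open ≡-Reasoning
  product-zero : (P Q.- Z) Q.* (x Q.- y) ≡ 0ℚ
  product-zero = begin
    (P Q.- Z) Q.* (x Q.- y)
      ≡⟨ solve 3 (λ p z w → (p :- z) :* w := p :* w :- z :* w) refl P Z (x Q.- y) ⟩
    P Q.* (x Q.- y) Q.- Z Q.* (x Q.- y)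
      ≡⟨ cong₂ Q._-_ (difference-form P P' x y P-rel) (difference-form Z Z' x y Z-rel) ⟩
    (0ℚ Q.- (P Q.+ P') Q.* y) Q.- (0ℚ Q.- (Z Q.+ Z') Q.* y)
      ≡⟨ cong (λ s → (0ℚ Q.- s Q.* y) Q.- (0ℚ Q.- (Z Q.+ Z') Q.* y)) same-sum ⟩
    (0ℚ Q.- (Z Q.+ Z') Q.* y) Q.- (0ℚ Q.- (Z Q.+ Z') Q.* y)
      ≡⟨ QP.+-inverseʳ (0ℚ Q.- (Z Q.+ Z') Q.* y) ⟩
    0ℚ ∎
  conclude : P Q.- Z ≡ 0ℚ ⊎ x Q.- y ≡ 0ℚ → P ≡ Z
  conclude (inj₁ P-Z≡0) = difference-zero P Z P-Z≡0
  conclude (inj₂ x-y≡0) = ⊥-elim (x≢y (difference-zero x y x-y≡0))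

sumℚ≡sum : ∀ {n} (f : Fin n → ℚ) → sumℚ f ≡ sum f
sumℚ≡sum {zero} f = refl
sumℚ≡sum {suc n} f = cong (f zero Q.+_) (sumℚ≡sum (λ i → f (suc i)))

sumℚ-cong : ∀ {n} {f g : Fin n → ℚ} → (∀ i → f i ≡ g i) → sumℚ f ≡ sumℚ g
sumℚ-cong {zero} _ = refl
sumℚ-cong {suc n} h = cong₂ Q._+_ (h zero) (sumℚ-cong (λ i → h (suc i)))

sumℚ-zero : ∀ n → sumℚ {n} (λ _ → 0ℚ) ≡ 0ℚ
sumℚ-zero n = trans (sumℚ≡sum {n} (λ _ → 0ℚ)) (sum-replicate-zero n)

sumℚ-+ : ∀ {n} (f g : Fin n → ℚ) → sumℚ (λ i → f i Q.+ g i) ≡ sumℚ f Q.+ sumℚ g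
sumℚ-+ f g = trans (sumℚ≡sum (λ i → f i Q.+ g i)) (trans (∑-distrib-+ f g)
  (sym (cong₂ Q._+_ (sumℚ≡sum f) (sumℚ≡sum g))))

sumℚ-*ˡ : ∀ {n} (c : ℚ) (f : Fin n → ℚ) → sumℚ (λ i → c Q.* f i) ≡ c Q.* sumℚ f
sumℚ-*ˡ c f = trans (sumℚ≡sum (λ i → c Q.* f i)) (trans (sym (*-distribˡ-sum c f))
  (sym (cong (c Q.*_) (sumℚ≡sum f))))

sumℚ-*ʳ : ∀ {n} (c : ℚ) (f : Fin n → ℚ) → sumℚ (λ i → f i Q.* c) ≡ sumℚ f Q.* c
sumℚ-*ʳ c f = trans (sumℚ-cong (λ i → QP.*-comm (f i) c))
  (trans (sumℚ-*ˡ c f) (QP.*-comm c (sumℚ f)))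

sumℚ-comm : ∀ {m n} (f : Fin m → Fin n → ℚ) →
  sumℚ (λ i → sumℚ (f i)) ≡ sumℚ (λ j → sumℚ (λ i → f i j))
sumℚ-comm f = begin
  sumℚ (λ i → sumℚ (f i))           ≡⟨ trans (sumℚ-cong (λ i → sumℚ≡sum (f i))) (sumℚ≡sum (λ i → sum (f i))) ⟩
  sum (λ i → sum (f i))             ≡⟨ ∑-comm f ⟩
  sum (λ j → sum (λ i → f i j))     ≡⟨ sym (trans (sumℚ-cong (λ j → sumℚ≡sum (λ i → f i j))) (sumℚ≡sum (λ j → sum (λ i → f i j)))) ⟩
  sumℚ (λ j → sumℚ (λ i → f i j))   ∎
  where open ≡-Reasoning

sumℚ-indicator : ∀ {n} (p : Fin n → Bool) (c : ℚ) →
  sumℚ (λ i → if p i then c else 0ℚ) ≡ ℕtoℚ (count p) Q.* c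
sumℚ-indicator {zero} p c = sym (QP.*-zeroˡ c)
sumℚ-indicator {suc n} p c with p zero
... | true rewrite sumℚ-indicator (λ i → p (suc i)) c | ℕtoℚ-suc (count (λ i → p (suc i))) =
  solve 2 (λ x y → x :+ y :* x := (con 1ℚ :+ y) :* x) refl c (ℕtoℚ (count (λ i → p (suc i))))
... | false rewrite sumℚ-indicator (λ i → p (suc i)) c = QP.+-identityˡ _

sumℚ-single : ∀ {n} (f : Fin n → ℚ) x → (∀ i → ¬ (i ≡ x) → f i ≡ 0ℚ) → sumℚ f ≡ f x
sumℚ-single {suc n} f zero h = begin
  f zero Q.+ sumℚ (λ i → f (suc i))  ≡⟨ cong (f zero Q.+_) (trans (sumℚ-cong (λ i → h (suc i) λ ())) (sumℚ-zero n)) ⟩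
  f zero Q.+ 0ℚ                      ≡⟨ QP.+-identityʳ _ ⟩
  f zero                             ∎
  where open ≡-Reasoning
sumℚ-single {suc n} f (suc x) h = begin
  f zero Q.+ sumℚ (λ i → f (suc i))  ≡⟨ cong (Q._+ sumℚ (λ i → f (suc i))) (h zero λ ()) ⟩
  0ℚ Q.+ sumℚ (λ i → f (suc i))      ≡⟨ QP.+-identityˡ _ ⟩
  sumℚ (λ i → f (suc i))             ≡⟨ sumℚ-single (λ i → f (suc i)) x (λ i i≢x → h (suc i) (λ e → i≢x (suc-injective e))) ⟩
  f (suc x)                          ∎
  where open ≡-Reasoning

sumℚ-nonneg : ∀ {n} (f : Fin n → ℚ) → (∀ i → 0ℚ Q.≤ f i) → 0ℚ Q.≤ sumℚ f
sumℚ-nonneg {zero} f h = QP.≤-refl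
sumℚ-nonneg {suc n} f h = subst (Q._≤ sumℚ f) (QP.+-identityˡ 0ℚ)
  (QP.+-mono-≤ (h zero) (sumℚ-nonneg (λ i → f (suc i)) (λ i → h (suc i))))

nonneg-+-zero : ∀ p q → 0ℚ Q.≤ p → 0ℚ Q.≤ q → p Q.+ q ≡ 0ℚ → p ≡ 0ℚ
nonneg-+-zero p q p≥0 q≥0 p+q≡0 =
  QP.≤-antisym (subst₂ Q._≤_ (QP.+-identityʳ p) p+q≡0 (QP.+-monoʳ-≤ p q≥0)) p≥0

sumℚ-nonneg-zero : ∀ {n} (f : Fin n → ℚ) → (∀ i → 0ℚ Q.≤ f i) → sumℚ f ≡ 0ℚ →
  ∀ i → f i ≡ 0ℚ
sumℚ-nonneg-zero f h e zero =
  nonneg-+-zero _ _ (h zero) (sumℚ-nonneg (λ j → f (suc j)) (λ j → h (suc j))) e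
sumℚ-nonneg-zero f h e (suc i) = sumℚ-nonneg-zero (λ j → f (suc j)) (λ j → h (suc j))
  (nonneg-+-zero _ _ (sumℚ-nonneg (λ j → f (suc j)) (λ j → h (suc j))) (h zero)
    (trans (QP.+-comm _ (f zero)) e)) i

𝟙 : Bool → ℚ
𝟙 β = if β then 1ℚ else 0ℚ

count-as-sum : ∀ {n} (p : Fin n → Bool) → ℕtoℚ (count p) ≡ sumℚ (λ i → 𝟙 (p i))
count-as-sum p = sym (trans (sumℚ-indicator p 1ℚ) (QP.*-identityʳ _))

count-guard : ∀ {l} (β : Bool) (q : Fin l → Bool) →
  ℕtoℚ (count (λ i → β ∧ q i)) ≡ (if β then ℕtoℚ (count q) else 0ℚ)
count-guard true q = refl
count-guard {l} false q = cong ℕtoℚ (count-none {l} (λ _ → false) (λ _ → refl))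

if-true : ∀ {β} {p : ℚ} → β ≡ true → (if β then p else 0ℚ) ≡ p
if-true refl = refl

if-false : ∀ {β} {p : ℚ} → β ≡ false → (if β then p else 0ℚ) ≡ 0ℚ
if-false refl = refl

𝟙-* : ∀ β p → 𝟙 β Q.* p ≡ (if β then p else 0ℚ)
𝟙-* true p = QP.*-identityˡ p
𝟙-* false p = QP.*-zeroˡ p

if-*-if : ∀ (β γ : Bool) p q →
  (if β then p else 0ℚ) Q.* (if γ then q else 0ℚ) ≡ (if β ∧ γ then p Q.* q else 0ℚ)
if-*-if true true p q = refl
if-*-if true false p q = QP.*-zeroʳ p
if-*-if false γ p q = QP.*-zeroˡ (if γ then q else 0ℚ)

*-if : ∀ (β : Bool) p q → p Q.* (if β then q else 0ℚ) ≡ (if β then p Q.* q else 0ℚ)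
*-if true p q = refl
*-if false p q = QP.*-zeroʳ p

module Distance {n : ℕ} (G : Graph n) where

  adj-flip : ∀ {x y β} → adj G x y ≡ β → adj G y x ≡ β
  adj-flip {x} {y} e = trans (adj-sym G y x) e

  adj⇒≢ : ∀ {x y} → adj G x y ≡ true → ¬ (x ≡ y)
  adj⇒≢ {x} a refl = true≢false a (adj-irrefl G x)

  within-0⁻ : ∀ {x y} → within G 0 x y ≡ true → x ≡ y
  within-0⁻ = ≟-true⁻

  within-refl : ∀ x → within G 0 x x ≡ true
  within-refl = ≟-refl

  within-suc : ∀ {k x y} → within G k x y ≡ true → within G (suc k) x y ≡ true
  within-suc h = ∨-trueˡ _ h

  within-mono : ∀ {k l x y} → k ≤ l → within G k x y ≡ true → within G l x y ≡ true
  within-mono {k} {l} k≤l h = go (ℕP.≤⇒≤′ k≤l) h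
    where
    go : ∀ {l} → k ℕ.≤′ l → within G k _ _ ≡ true → within G l _ _ ≡ true
    go ℕ.≤′-refl h = h
    go (ℕ.≤′-step {l} k≤l) h = within-suc {l} (go k≤l h)

  within-step : ∀ k {x y z} → within G k x y ≡ true → adj G y z ≡ true →
    within G (suc k) x z ≡ true
  within-step zero {x} {z = z} h a with within-0⁻ h
  ... | refl = ∨-trueʳ ⌊ x ≟ z ⌋ (anyFin-intro _ z (∧-true a (≟-refl z)))
  within-step (suc k) {x} {y} {z} h a with ∨-true⁻ {within G k x y} h
  ... | inj₁ h₁ = within-suc {suc k} (within-step k h₁ a)
  ... | inj₂ h₂ with anyFin-witness _ h₂
  ...   | w , hw with ∧-true⁻ {adj G x w} hw
  ...     | axw , w-y = ∨-trueʳ (within G (suc k) x z) (anyFin-intro _ w (∧-true axw (within-step k w-y a)))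

  within-sym : ∀ k {x y} → within G k x y ≡ true → within G k y x ≡ true
  within-sym zero h with within-0⁻ h
  ... | refl = h
  within-sym (suc k) {x} {y} h with ∨-true⁻ {within G k x y} h
  ... | inj₁ h₁ = within-suc {k} (within-sym k h₁)
  ... | inj₂ h₂ with anyFin-witness _ h₂
  ...   | w , hw with ∧-true⁻ {adj G x w} hw
  ...     | axw , w-y = within-step k (within-sym k w-y) (adj-flip axw)

  within-1⁻ : ∀ {x y} → within G 1 x y ≡ true → x ≡ y ⊎ adj G x y ≡ true
  within-1⁻ {x} {y} h with ∨-true⁻ {within G 0 x y} h
  ... | inj₁ h₀ = inj₁ (within-0⁻ h₀)
  ... | inj₂ h₁ = inj₂ (trans (sym (anyFin-at (adj G x) y)) h₁)

  adj⇒within-1 : ∀ {x y} → adj G x y ≡ true → within G 1 x y ≡ true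
  adj⇒within-1 {x} a = within-step 0 (within-refl x) a

  dist-1≡adj : ∀ x y → distIs G 1 x y ≡ adj G x y
  dist-1≡adj x y with x ≟ y
  ... | yes refl = sym (adj-irrefl G x)
  ... | no _ = trans (cong (_∧ true) (anyFin-at (adj G x) y)) (∧-identityʳ (adj G x y))

  dist⇒within : ∀ i {x y} → distIs G i x y ≡ true → within G i x y ≡ true
  dist⇒within zero h = h
  dist⇒within (suc i) h = proj₁ (∧-true⁻ h)

  dist⇒¬within : ∀ i {x y} → distIs G (suc i) x y ≡ true → within G i x y ≡ false
  dist⇒¬within i h = not-true⁻ (proj₂ (∧-true⁻ h))

  dist-intro : ∀ i {x y} → within G (suc i) x y ≡ true → within G i x y ≡ false →
    distIs G (suc i) x y ≡ true
  dist-intro i h₁ h₂ = ∧-true h₁ (not-true h₂)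

  dist-least : ∀ j {x y} → within G j x y ≡ true → (∀ i → i < j → within G i x y ≡ false) →
    distIs G j x y ≡ true
  dist-least zero h _ = h
  dist-least (suc j) h shorter = dist-intro j h (shorter j ℕP.≤-refl)

  dist-< : ∀ {i j x y} → i < j → distIs G i x y ≡ true → distIs G j x y ≡ true → ⊥
  dist-< {i} {suc j} (s≤s i≤j) hi hj =
    true≢false (within-mono i≤j (dist⇒within i hi)) (dist⇒¬within j hj)

  dist-unique : ∀ i j {x y} → distIs G i x y ≡ true → distIs G j x y ≡ true → i ≡ j
  dist-unique i j hi hj with ℕP.<-cmp i j
  ... | tri< i<j _ _ = ⊥-elim (dist-< i<j hi hj)
  ... | tri≈ _ i≡j _ = i≡j
  ... | tri> _ _ j<i = ⊥-elim (dist-< j<i hj hi)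

  dist-exclusive : ∀ i j {x y} → distIs G i x y ≡ true → ¬ (i ≡ j) → distIs G j x y ≡ false
  dist-exclusive i j hi i≢j = ¬true⇒false λ hj → i≢j (dist-unique i j hi hj)

  dist-sym : ∀ i {x y} → distIs G i x y ≡ true → distIs G i y x ≡ true
  dist-sym zero h = within-sym 0 h
  dist-sym (suc i) h = dist-intro i (within-sym (suc i) (dist⇒within (suc i) h))
    (¬true⇒false λ h' → true≢false (within-sym i h') (dist⇒¬within i h))

  dist-pred : ∀ i {v t u} → distIs G (suc i) v t ≡ true → adj G u t ≡ true →
    within G i v u ≡ true → distIs G i v u ≡ true
  dist-pred zero _ _ h = h
  dist-pred (suc i) ht a h =
    dist-intro i h (¬true⇒false λ h' → true≢false (within-step i h' a) (dist⇒¬within (suc i) ht))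

  dist-neighbour : ∀ i {v t u} → distIs G (suc i) v t ≡ true → adj G t u ≡ true →
    distIs G i v u ≡ true ⊎ distIs G (suc i) v u ≡ true ⊎ distIs G (suc (suc i)) v u ≡ true
  dist-neighbour i {v} {t} {u} ht a = bool-cases (within G i v u)
    (λ near → inj₁ (dist-pred i ht (adj-flip a) near))
    (λ far → bool-cases (within G (suc i) v u)
      (λ mid → inj₂ (inj₁ (dist-intro i mid far)))
      (λ far' → inj₂ (inj₂ (dist-intro (suc i) (within-step (suc i) (dist⇒within (suc i) ht) a) far'))))

  dist-last-step : ∀ i {v w} → distIs G (suc i) v w ≡ true →
    ∃ λ u → adj G w u ≡ true × distIs G i v u ≡ true
  dist-last-step i {v} {w} h with ∨-true⁻ {within G i w v} (dist⇒within (suc i) (dist-sym (suc i) h))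
  ... | inj₁ h₁ = ⊥-elim (true≢false (within-sym i h₁) (dist⇒¬within i h))
  ... | inj₂ h₂ with anyFin-witness _ h₂
  ...   | u , hu with ∧-true⁻ {adj G w u} hu
  ...     | awu , u-v = u , awu , dist-pred i h (adj-flip awu) (within-sym i u-v)

  dist-shorter : ∀ j {v w} → distIs G j v w ≡ true → ∀ i → i ≤ j → ∃ λ u → distIs G i v u ≡ true
  dist-shorter zero h zero z≤n = _ , h
  dist-shorter (suc j) h i i≤1+j with ℕP.m≤n⇒m<n∨m≡n i≤1+j
  ... | inj₂ refl = _ , h
  ... | inj₁ (s≤s i≤j) = dist-shorter j (proj₂ (proj₂ (dist-last-step j h))) i i≤j

  dist-2-≢ : ∀ {x y} → distIs G 2 x y ≡ true → ¬ (x ≡ y)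
  dist-2-≢ {x} h refl = true≢false (within-suc {0} (within-refl x)) (dist⇒¬within 1 h)

  dist-2-nonadj : ∀ {x y} → distIs G 2 x y ≡ true → adj G x y ≡ false
  dist-2-nonadj h = ¬true⇒false λ a → true≢false (adj⇒within-1 a) (dist⇒¬within 1 h)

  dist-2-intro : ∀ {x y z} → ¬ (x ≡ y) → adj G x y ≡ false → adj G x z ≡ true →
    adj G z y ≡ true → distIs G 2 x y ≡ true
  dist-2-intro {x} {y} x≢y x≁y axz azy =
    dist-intro 1 (within-step 1 (adj⇒within-1 axz) azy) (¬true⇒false λ h → close (within-1⁻ h))
    where
    close : x ≡ y ⊎ adj G x y ≡ true → ⊥
    close (inj₁ x≡y) = x≢y x≡y
    close (inj₂ x~y) = true≢false x~y x≁y

  distSet-1-intro : ∀ {y} (C : Fin n → Bool) → C y ≡ false → ∀ c → C c ≡ true →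
    adj G y c ≡ true → distSetIs G 1 y C ≡ true
  distSet-1-intro {y} C y∉C c c∈C a = ∧-true (anyFin-intro _ c (∧-true c∈C (adj⇒within-1 a)))
    (not-true (¬true⇒false λ h → not-at-0 (anyFin-witness _ h)))
    where
    not-at-0 : (∃ λ c → (C c ∧ within G 0 y c) ≡ true) → ⊥
    not-at-0 (c' , hc) with ∧-true⁻ {C c'} hc
    ... | c'∈C , y-c' with within-0⁻ y-c'
    ...   | refl = true≢false c'∈C y∉C

applyA-self-adjoint : ∀ {n} (G : Graph n) (f g : Fin n → ℚ) →
  sumℚ (λ t → f t Q.* applyA G g t) ≡ sumℚ (λ u → g u Q.* applyA G f u)
applyA-self-adjoint G f g = begin
  sumℚ (λ t → f t Q.* applyA G g t)
    ≡⟨ sumℚ-cong (λ t → sym (sumℚ-*ˡ (f t) (λ u → if adj G t u then g u else 0ℚ))) ⟩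
  sumℚ (λ t → sumℚ (λ u → f t Q.* (if adj G t u then g u else 0ℚ)))
    ≡⟨ sumℚ-comm (λ t u → f t Q.* (if adj G t u then g u else 0ℚ)) ⟩
  sumℚ (λ u → sumℚ (λ t → f t Q.* (if adj G t u then g u else 0ℚ)))
    ≡⟨ sumℚ-cong (λ u → sumℚ-cong (λ t → swap (adj G t u) (adj G u t) (adj-sym G t u) (f t) (g u))) ⟩
  sumℚ (λ u → sumℚ (λ t → g u Q.* (if adj G u t then f t else 0ℚ)))
    ≡⟨ sumℚ-cong (λ u → sumℚ-*ˡ (g u) (λ t → if adj G u t then f t else 0ℚ)) ⟩
  sumℚ (λ u → g u Q.* applyA G f u) ∎
  where
  open ≡-Reasoning
  swap : ∀ β γ → β ≡ γ → ∀ p q → p Q.* (if β then q else 0ℚ) ≡ q Q.* (if γ then p else 0ℚ)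
  swap true .true refl p q = QP.*-comm p q
  swap false .false refl p q = trans (QP.*-zeroʳ p) (sym (QP.*-zeroʳ q))

module InducedK {n : ℕ} (G : Graph n) where
  open Distance G

  induced-K-p2 : ∀ {p} (x y : Fin n) (z : Fin p → Fin n) →
    ¬ (x ≡ y) → adj G x y ≡ false → Injective _≡_ _≡_ z →
    (∀ i j → ¬ (i ≡ j) → adj G (z i) (z j) ≡ false) →
    (∀ i → adj G x (z i) ≡ true) → (∀ i → adj G y (z i) ≡ true) →
    HasInducedK G p 2
  induced-K-p2 {p} x y z x≢y x≁y z-inj z-indep x~z y~z = embed , embed-inj , embed-adj
    where
    embed : Fin p ⊎ Fin 2 → Fin n
    embed (inj₁ i) = z i
    embed (inj₂ zero) = x
    embed (inj₂ (suc zero)) = y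

    embed-adj : ∀ u v → adj G (embed u) (embed v) ≡ KAdj u v
    embed-adj (inj₁ i) (inj₁ j) with i ≟ j
    ... | yes refl = adj-irrefl G (z i)
    ... | no i≢j = z-indep i j i≢j
    embed-adj (inj₁ i) (inj₂ zero) = adj-flip (x~z i)
    embed-adj (inj₁ i) (inj₂ (suc zero)) = adj-flip (y~z i)
    embed-adj (inj₂ zero) (inj₁ i) = x~z i
    embed-adj (inj₂ (suc zero)) (inj₁ i) = y~z i
    embed-adj (inj₂ zero) (inj₂ zero) = adj-irrefl G x
    embed-adj (inj₂ zero) (inj₂ (suc zero)) = x≁y
    embed-adj (inj₂ (suc zero)) (inj₂ zero) = adj-flip x≁y
    embed-adj (inj₂ (suc zero)) (inj₂ (suc zero)) = adj-irrefl G y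

    embed-inj : Injective _≡_ _≡_ embed
    embed-inj {inj₁ i} {inj₁ j} e = cong inj₁ (z-inj e)
    embed-inj {inj₁ i} {inj₂ zero} e = ⊥-elim (adj⇒≢ (x~z i) (sym e))
    embed-inj {inj₁ i} {inj₂ (suc zero)} e = ⊥-elim (adj⇒≢ (y~z i) (sym e))
    embed-inj {inj₂ zero} {inj₁ i} e = ⊥-elim (adj⇒≢ (x~z i) e)
    embed-inj {inj₂ (suc zero)} {inj₁ i} e = ⊥-elim (adj⇒≢ (y~z i) e)
    embed-inj {inj₂ zero} {inj₂ zero} e = refl
    embed-inj {inj₂ zero} {inj₂ (suc zero)} e = ⊥-elim (x≢y e)
    embed-inj {inj₂ (suc zero)} {inj₂ zero} e = ⊥-elim (x≢y (sym e))
    embed-inj {inj₂ (suc zero)} {inj₂ (suc zero)} e = refl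

  induced-quadrangle : ∀ x y u w → ¬ (x ≡ y) → adj G x y ≡ false →
    ¬ (u ≡ w) → adj G u w ≡ false →
    adj G x u ≡ true → adj G y u ≡ true → adj G x w ≡ true → adj G y w ≡ true →
    HasInducedK G 2 2
  induced-quadrangle x y u w x≢y x≁y u≢w u≁w x~u y~u x~w y~w =
    induced-K-p2 x y z x≢y x≁y z-inj z-indep x~z y~z
    where
    z : Fin 2 → Fin n
    z zero = u
    z (suc zero) = w
    z-inj : Injective _≡_ _≡_ z
    z-inj {zero} {zero} _ = refl
    z-inj {zero} {suc zero} e = ⊥-elim (u≢w e)
    z-inj {suc zero} {zero} e = ⊥-elim (u≢w (sym e))
    z-inj {suc zero} {suc zero} _ = refl
    z-indep : ∀ i j → ¬ (i ≡ j) → adj G (z i) (z j) ≡ false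
    z-indep zero zero i≢j = ⊥-elim (i≢j refl)
    z-indep zero (suc zero) _ = u≁w
    z-indep (suc zero) zero _ = adj-flip u≁w
    z-indep (suc zero) (suc zero) i≢j = ⊥-elim (i≢j refl)
    x~z : ∀ i → adj G x (z i) ≡ true
    x~z zero = x~u
    x~z (suc zero) = x~w
    y~z : ∀ i → adj G y (z i) ≡ true
    y~z zero = y~u
    y~z (suc zero) = y~w

-- Clique geometries: a family 𝒞 of cliques such that every edge lies in exactly
-- one member.
module CliqueGeometry {n m : ℕ} (G : Graph n) (𝒞 : Fin m → Fin n → Bool)
  (is-clique : ∀ j → IsClique G (𝒞 j))
  (edge-in-one : ∀ x y → adj G x y ≡ true → count (λ j → 𝒞 j x ∧ 𝒞 j y) ≡ 1) where
  open Distance G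

  clique-through : ∀ x y → adj G x y ≡ true → Σ (Fin m) λ j → 𝒞 j x ≡ true × 𝒞 j y ≡ true
  clique-through x y x~y with count-witness (λ j → 𝒞 j x ∧ 𝒞 j y)
                                (subst (1 ≤_) (sym (edge-in-one x y x~y)) (s≤s z≤n))
  ... | j , hj = j , ∧-true⁻ hj

  same-clique : ∀ {x y j j'} → adj G x y ≡ true → 𝒞 j x ≡ true → 𝒞 j y ≡ true →
    𝒞 j' x ≡ true → 𝒞 j' y ≡ true → j ≡ j'
  same-clique {x} {y} x~y jx jy j'x j'y =
    count-unique (λ l → 𝒞 l x ∧ 𝒞 l y) (edge-in-one x y x~y) _ _ (∧-true jx jy) (∧-true j'x j'y)

  -- If ψ₁ = 1 and dist(x,y) = 2, each of the τ₂
  -- cliques C through x at distance 1 from y contains exactly one neighbour z_C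
  -- of y.  Distinct cliques give distinct, non-adjacent z_C (an edge z_C z_C'
  -- would give y or z_C' two neighbours in one clique), so x, y and the z_C
  -- induce a K_{τ₂,2}.
  module ψ₁≡1 (ψ₁-one : Psi1IsOne G 𝒞) (x y : Fin n) (xy-2 : distIs G 2 x y ≡ true) where

    one-neighbour : ∀ j w → distSetIs G 1 w (𝒞 j) ≡ true → count (λ c → 𝒞 j c ∧ adj G w c) ≡ 1
    one-neighbour j w h = trans (count-cong (λ c → cong (𝒞 j c ∧_) (sym (dist-1≡adj w c)))) (ψ₁-one j w h)

    near : Fin m → Bool
    near j = 𝒞 j x ∧ distSetIs G 1 y (𝒞 j)

    clique : Fin (count near) → Fin m
    clique = enumerate near

    x∈ : ∀ i → 𝒞 (clique i) x ≡ true
    x∈ i = proj₁ (∧-true⁻ (enumerate-sound near i))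

    y-near : ∀ i → distSetIs G 1 y (𝒞 (clique i)) ≡ true
    y-near i = proj₂ (∧-true⁻ {𝒞 (clique i) x} (enumerate-sound near i))

    y-neighbour-in : Fin (count near) → Fin n → Bool
    y-neighbour-in i c = 𝒞 (clique i) c ∧ adj G y c

    z : Fin (count near) → Fin n
    z i = enumerate (y-neighbour-in i)
            (subst Fin (sym (one-neighbour (clique i) y (y-near i))) zero)

    z∈ : ∀ i → 𝒞 (clique i) (z i) ≡ true
    z∈ i = proj₁ (∧-true⁻ (enumerate-sound (y-neighbour-in i) _))

    y~z : ∀ i → adj G y (z i) ≡ true
    y~z i = proj₂ (∧-true⁻ {𝒞 (clique i) (z i)} (enumerate-sound (y-neighbour-in i) _))

    z≢x : ∀ i → ¬ (z i ≡ x)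
    z≢x i z≡x = true≢false (adj-flip (subst (λ c → adj G y c ≡ true) z≡x (y~z i))) (dist-2-nonadj xy-2)

    x~z : ∀ i → adj G x (z i) ≡ true
    x~z i = is-clique (clique i) x (z i) (x∈ i) (z∈ i) (λ e → z≢x i (sym e))

    z-injective : Injective _≡_ _≡_ z
    z-injective {i} {i'} e = enumerate-injective near
      (same-clique (x~z i) (x∈ i) (z∈ i) (x∈ i') (subst (λ c → 𝒞 (clique i') c ≡ true) (sym e) (z∈ i')))

    z-independent : ∀ i i' → ¬ (i ≡ i') → adj G (z i) (z i') ≡ false
    z-independent i i' i≢i' = ¬true⇒false λ zz → bool-cases (𝒞 (clique i) (z i'))
      (λ z'∈ → i≢i' (z-injective (count-unique (y-neighbour-in i)
        (one-neighbour (clique i) y (y-near i)) (z i) (z i')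
        (enumerate-sound (y-neighbour-in i) _) (∧-true z'∈ (y~z i')))))
      (λ z'∉ → z≢x i (sym (count-unique (λ c → 𝒞 (clique i) c ∧ adj G (z i') c)
        (one-neighbour (clique i) (z i') (distSet-1-intro (𝒞 (clique i)) z'∉ (z i) (z∈ i) (adj-flip zz)))
        x (z i) (∧-true (x∈ i) (adj-flip (x~z i'))) (∧-true (z∈ i) (adj-flip zz)))))

    induced-K-τ₂-2 : HasInducedK G (tauAt G 𝒞 2 x y) 2
    induced-K-τ₂-2 = InducedK.induced-K-p2 G x y z (dist-2-≢ xy-2) (dist-2-nonadj xy-2)
      z-injective z-independent x~z y~z

module DelsarteGeometry {n m : ℕ} (G : Graph n) (k : ℕ) (θ : ℚ) (𝒞 : Fin m → Fin n → Bool)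
  (regular : ∀ u → count (adj G u) ≡ k) (k≥1 : 1 ≤ k)
  (geometry : IsDelsarteCliqueGeometry G k θ m 𝒞) where
  open Distance G

  is-clique : ∀ j → IsClique G (𝒞 j)
  is-clique j = proj₁ (proj₁ geometry j)

  delsarte : ∀ j → ℕtoℚ (count (𝒞 j)) Q.* θ ≡ θ Q.- ℕtoℚ k
  delsarte j = proj₂ (proj₁ geometry j)

  edge-in-one : ∀ x y → adj G x y ≡ true → count (λ j → 𝒞 j x ∧ 𝒞 j y) ≡ 1
  edge-in-one = proj₂ geometry

  others : Fin m → Fin n → ℕ
  others j u = count (λ y → 𝒞 j y ∧ not ⌊ y ≟ u ⌋)

  others-θ : ∀ j u → 𝒞 j u ≡ true → ℕtoℚ (others j u) Q.* θ ≡ Q.- ℕtoℚ k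
  others-θ j u u∈C = begin
    O Q.* θ                               ≡⟨ solve 2 (λ o t → o :* t := (con 1ℚ :+ o) :* t :- t) refl O θ ⟩
    (1ℚ Q.+ O) Q.* θ Q.- θ                ≡⟨ cong (λ s → s Q.* θ Q.- θ) (sym size) ⟩
    ℕtoℚ (count (𝒞 j)) Q.* θ Q.- θ        ≡⟨ cong (Q._- θ) (delsarte j) ⟩
    θ Q.- ℕtoℚ k Q.- θ                    ≡⟨ solve 2 (λ t k → t :- k :- t := :- k) refl θ (ℕtoℚ k) ⟩
    Q.- ℕtoℚ k                            ∎
    where
    open ≡-Reasoning
    O = ℕtoℚ (others j u)
    just-u : count (λ y → 𝒞 j y ∧ ⌊ y ≟ u ⌋) ≡ 1
    just-u = ℕtoℚ-injective (trans (count-as-sum (λ y → 𝒞 j y ∧ ⌊ y ≟ u ⌋)) (trans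
      (sumℚ-single (λ y → 𝟙 (𝒞 j y ∧ ⌊ y ≟ u ⌋)) u (λ y y≢u → cong 𝟙 (trans (cong (𝒞 j y ∧_) (≟-false y≢u)) (∧-zeroʳ (𝒞 j y)))))
      (cong 𝟙 (∧-true u∈C (≟-refl u)))))
    size : ℕtoℚ (count (𝒞 j)) ≡ 1ℚ Q.+ O
    size = trans (cong ℕtoℚ (count-split (𝒞 j) (λ y → ⌊ y ≟ u ⌋)))
           (trans (ℕtoℚ-+ (count (λ y → 𝒞 j y ∧ ⌊ y ≟ u ⌋)) (others j u)) (cong (λ c → ℕtoℚ c Q.+ O) just-u))

  neighbour-cliques : ∀ u y →
    𝟙 (adj G u y) ≡ ℕtoℚ (count (λ j → 𝒞 j u ∧ (𝒞 j y ∧ not ⌊ y ≟ u ⌋)))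
  neighbour-cliques u y = bool-cases (adj G u y)
    (λ u~y → trans (cong 𝟙 u~y) (sym (cong ℕtoℚ (trans
      (count-cong (λ j → cong (λ β → 𝒞 j u ∧ (𝒞 j y ∧ not β)) (≟-false (λ y≡u → adj⇒≢ u~y (sym y≡u)))))
      (trans (count-cong (λ j → cong (𝒞 j u ∧_) (∧-identityʳ (𝒞 j y)))) (edge-in-one u y u~y))))))
    (λ u≁y → trans (cong 𝟙 u≁y) (sym (cong ℕtoℚ (count-none _ (λ j → ¬true⇒false (shared j u≁y))))))
    where
    shared : ∀ j → adj G u y ≡ false → (𝒞 j u ∧ (𝒞 j y ∧ not ⌊ y ≟ u ⌋)) ≡ true → ⊥
    shared j u≁y h with ∧-true⁻ {𝒞 j u} h
    ... | u∈C , h' with ∧-true⁻ {𝒞 j y} h'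
    ...   | y∈C , y≢u = true≢false
      (is-clique j u y u∈C y∈C (λ u≡y → true≢false (≟-true⁻-sym u≡y) (not-true⁻ y≢u))) u≁y
      where
      ≟-true⁻-sym : u ≡ y → ⌊ y ≟ u ⌋ ≡ true
      ≟-true⁻-sym refl = ≟-refl u

  -- Double counting the neighbours of u along the cliques through u.
  degree-by-cliques : ∀ u → ℕtoℚ k ≡ sumℚ (λ j → if 𝒞 j u then ℕtoℚ (others j u) else 0ℚ)
  degree-by-cliques u = begin
    ℕtoℚ k                                 ≡⟨ cong ℕtoℚ (sym (regular u)) ⟩
    ℕtoℚ (count (adj G u))                 ≡⟨ count-as-sum (adj G u) ⟩
    sumℚ (λ y → 𝟙 (adj G u y))             ≡⟨ sumℚ-cong (λ y → trans (neighbour-cliques u y) (count-as-sum (λ j → P j y))) ⟩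
    sumℚ (λ y → sumℚ (λ j → 𝟙 (P j y)))    ≡⟨ sumℚ-comm (λ y j → 𝟙 (P j y)) ⟩
    sumℚ (λ j → sumℚ (λ y → 𝟙 (P j y)))    ≡⟨ sumℚ-cong (λ j → trans (sym (count-as-sum (P j))) (count-guard (𝒞 j u) (λ y → 𝒞 j y ∧ not ⌊ y ≟ u ⌋))) ⟩
    sumℚ (λ j → if 𝒞 j u then ℕtoℚ (others j u) else 0ℚ) ∎
    where
    open ≡-Reasoning
    P : Fin m → Fin n → Bool
    P j y = 𝒞 j u ∧ (𝒞 j y ∧ not ⌊ y ≟ u ⌋)

  -- Every vertex lies in exactly -θ cliques of 𝒞: from the two previous
  -- lemmas k·θ = r·(-k) for the number r of cliques through u, and k ≠ 0.
  cliques-through : ∀ u → ℕtoℚ (count (λ j → 𝒞 j u)) ≡ Q.- θ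
  cliques-through u = begin
    r                          ≡⟨ solve 2 (λ t r → r := (t :+ r) :- t) refl θ r ⟩
    (θ Q.+ r) Q.- θ            ≡⟨ cong (Q._- θ) θ+r≡0 ⟩
    0ℚ Q.- θ                   ≡⟨ QP.+-identityˡ (Q.- θ) ⟩
    Q.- θ                      ∎
    where
    open ≡-Reasoning
    K = ℕtoℚ k
    r = ℕtoℚ (count (λ j → 𝒞 j u))
    kθ : K Q.* θ ≡ r Q.* (Q.- K)
    kθ = begin
      K Q.* θ   ≡⟨ cong (Q._* θ) (degree-by-cliques u) ⟩
      sumℚ (λ j → if 𝒞 j u then ℕtoℚ (others j u) else 0ℚ) Q.* θ
        ≡⟨ sym (sumℚ-*ʳ θ (λ j → if 𝒞 j u then ℕtoℚ (others j u) else 0ℚ)) ⟩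
      sumℚ (λ j → (if 𝒞 j u then ℕtoℚ (others j u) else 0ℚ) Q.* θ)
        ≡⟨ sumℚ-cong (λ j → bool-cases (𝒞 j u)
             (λ u∈C → trans (cong (λ β → (if β then ℕtoℚ (others j u) else 0ℚ) Q.* θ) u∈C)
               (trans (others-θ j u u∈C) (cong (λ β → if β then Q.- K else 0ℚ) (sym u∈C))))
             (λ u∉C → trans (cong (λ β → (if β then ℕtoℚ (others j u) else 0ℚ) Q.* θ) u∉C)
               (trans (QP.*-zeroˡ θ) (cong (λ β → if β then Q.- K else 0ℚ) (sym u∉C))))) ⟩
      sumℚ (λ j → if 𝒞 j u then Q.- K else 0ℚ)  ≡⟨ sumℚ-indicator (λ j → 𝒞 j u) (Q.- K) ⟩
      r Q.* (Q.- K) ∎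
    θ+r≡0 : θ Q.+ r ≡ 0ℚ
    θ+r≡0 = *-zero-cancelˡ K (θ Q.+ r)
      (trans (solve 3 (λ k t r → k :* (t :+ r) := k :* t :- r :* (:- k)) refl K θ r)
      (trans (cong (Q._- r Q.* (Q.- K)) kθ) (QP.+-inverseʳ (r Q.* (Q.- K)))))
      (ℕtoℚ-positive k≥1)

  -- N Nᵀ = -θ I + A for the vertex–clique incidence matrix N of 𝒞.
  common-cliques : ∀ c c' → ℕtoℚ (count (λ j → 𝒞 j c ∧ 𝒞 j c')) ≡
    (if ⌊ c ≟ c' ⌋ then Q.- θ else 0ℚ) Q.+ 𝟙 (adj G c c')
  common-cliques c c' with c ≟ c'
  ... | yes refl = begin
    ℕtoℚ (count (λ j → 𝒞 j c ∧ 𝒞 j c))  ≡⟨ cong ℕtoℚ (count-cong (λ j → ∧-idem (𝒞 j c))) ⟩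
    ℕtoℚ (count (λ j → 𝒞 j c))          ≡⟨ cliques-through c ⟩
    Q.- θ                               ≡⟨ sym (QP.+-identityʳ (Q.- θ)) ⟩
    Q.- θ Q.+ 0ℚ                        ≡⟨ cong (λ β → Q.- θ Q.+ 𝟙 β) (sym (adj-irrefl G c)) ⟩
    Q.- θ Q.+ 𝟙 (adj G c c)             ∎
    where open ≡-Reasoning
  ... | no c≢c' = bool-cases (adj G c c')
    (λ c~c' → trans (cong ℕtoℚ (edge-in-one c c' c~c'))
      (trans (sym (QP.+-identityˡ 1ℚ)) (cong (λ β → 0ℚ Q.+ 𝟙 β) (sym c~c'))))
    (λ c≁c' → trans (cong ℕtoℚ (count-none _ (λ j → ¬true⇒false λ h →
        true≢false (is-clique j c c' (proj₁ (∧-true⁻ h)) (proj₂ (∧-true⁻ h)) c≢c') c≁c')))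
      (trans (sym (QP.+-identityˡ 0ℚ)) (cong (λ β → 0ℚ Q.+ 𝟙 β) (sym c≁c'))))

  clique-sum : (Fin n → ℚ) → Fin m → ℚ
  clique-sum φ j = sumℚ (λ c → if 𝒞 j c then φ c else 0ℚ)

  -- Σ_C (Σ_{c∈C} φ c)² = ⟨φ, (A - θ) φ⟩, the quadratic form of N Nᵀ = A - θ I.
  clique-sums-squared : ∀ φ → sumℚ (λ j → clique-sum φ j Q.* clique-sum φ j) ≡
    sumℚ (λ c → φ c Q.* (applyA G φ c Q.- θ Q.* φ c))
  clique-sums-squared φ = begin
    sumℚ (λ j → S j Q.* S j)
      ≡⟨ sumℚ-cong (λ j → trans (sym (sumℚ-*ʳ (S j) (f j))) (sumℚ-cong (λ c → sym (sumℚ-*ˡ (f j c) (f j))))) ⟩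
    sumℚ (λ j → sumℚ (λ c → sumℚ (λ c' → f j c Q.* f j c')))
      ≡⟨ sumℚ-comm (λ j c → sumℚ (λ c' → f j c Q.* f j c')) ⟩
    sumℚ (λ c → sumℚ (λ j → sumℚ (λ c' → f j c Q.* f j c')))
      ≡⟨ sumℚ-cong (λ c → sumℚ-comm (λ j c' → f j c Q.* f j c')) ⟩
    sumℚ (λ c → sumℚ (λ c' → sumℚ (λ j → f j c Q.* f j c')))
      ≡⟨ sumℚ-cong (λ c → sumℚ-cong (pair-term c)) ⟩
    sumℚ (λ c → sumℚ (λ c' → D c c' Q.+ φ c Q.* Aφ c c'))
      ≡⟨ sumℚ-cong row ⟩
    sumℚ (λ c → φ c Q.* (applyA G φ c Q.- θ Q.* φ c)) ∎
    where
    open ≡-Reasoning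
    f : Fin m → Fin n → ℚ
    f j c = if 𝒞 j c then φ c else 0ℚ
    S = clique-sum φ
    δθ : Fin n → Fin n → ℚ
    δθ c c' = if ⌊ c ≟ c' ⌋ then Q.- θ else 0ℚ
    D Aφ : Fin n → Fin n → ℚ
    D c c' = δθ c c' Q.* (φ c Q.* φ c')
    Aφ c c' = if adj G c c' then φ c' else 0ℚ

    pair-term : ∀ c c' → sumℚ (λ j → f j c Q.* f j c') ≡ D c c' Q.+ φ c Q.* Aφ c c'
    pair-term c c' = begin
      sumℚ (λ j → f j c Q.* f j c')
        ≡⟨ sumℚ-cong (λ j → if-*-if (𝒞 j c) (𝒞 j c') (φ c) (φ c')) ⟩
      sumℚ (λ j → if 𝒞 j c ∧ 𝒞 j c' then φ c Q.* φ c' else 0ℚ)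
        ≡⟨ sumℚ-indicator (λ j → 𝒞 j c ∧ 𝒞 j c') (φ c Q.* φ c') ⟩
      ℕtoℚ (count (λ j → 𝒞 j c ∧ 𝒞 j c')) Q.* (φ c Q.* φ c')
        ≡⟨ cong (Q._* (φ c Q.* φ c')) (common-cliques c c') ⟩
      (δθ c c' Q.+ 𝟙 (adj G c c')) Q.* (φ c Q.* φ c')
        ≡⟨ QP.*-distribʳ-+ (φ c Q.* φ c') (δθ c c') (𝟙 (adj G c c')) ⟩
      D c c' Q.+ 𝟙 (adj G c c') Q.* (φ c Q.* φ c')
        ≡⟨ cong (D c c' Q.+_) (trans (𝟙-* (adj G c c') (φ c Q.* φ c')) (sym (*-if (adj G c c') (φ c) (φ c')))) ⟩
      D c c' Q.+ φ c Q.* Aφ c c' ∎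

    diagonal : ∀ c → sumℚ (D c) ≡ Q.- θ Q.* (φ c Q.* φ c)
    diagonal c = trans (sumℚ-single (D c) c (λ c' c'≢c → trans
        (cong (λ β → (if β then Q.- θ else 0ℚ) Q.* (φ c Q.* φ c')) (≟-false (λ c≡c' → c'≢c (sym c≡c'))))
        (QP.*-zeroˡ (φ c Q.* φ c'))))
      (cong (λ β → (if β then Q.- θ else 0ℚ) Q.* (φ c Q.* φ c)) (≟-refl c))

    row : ∀ c → sumℚ (λ c' → D c c' Q.+ φ c Q.* Aφ c c') ≡ φ c Q.* (applyA G φ c Q.- θ Q.* φ c)
    row c = begin
      sumℚ (λ c' → D c c' Q.+ φ c Q.* Aφ c c')
        ≡⟨ sumℚ-+ (D c) (λ c' → φ c Q.* Aφ c c') ⟩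
      sumℚ (D c) Q.+ sumℚ (λ c' → φ c Q.* Aφ c c')
        ≡⟨ cong₂ Q._+_ (diagonal c) (sumℚ-*ˡ (φ c) (Aφ c)) ⟩
      Q.- θ Q.* (φ c Q.* φ c) Q.+ φ c Q.* applyA G φ c
        ≡⟨ solve 3 (λ t x y → :- t :* (x :* x) :+ x :* y := x :* (y :- t :* x)) refl θ (φ c) (applyA G φ c) ⟩
      φ c Q.* (applyA G φ c Q.- θ Q.* φ c) ∎

  eigenvector-clique-sum : ∀ φ → (∀ u → applyA G φ u ≡ θ Q.* φ u) → ∀ j → clique-sum φ j ≡ 0ℚ
  eigenvector-clique-sum φ eigen j = square-zero (clique-sum φ j)
    (sumℚ-nonneg-zero (λ j → clique-sum φ j Q.* clique-sum φ j) (λ j → square-nonneg (clique-sum φ j))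
      (trans (clique-sums-squared φ) (trans (sumℚ-cong vanish) (sumℚ-zero n))) j)
    where
    vanish : ∀ c → φ c Q.* (applyA G φ c Q.- θ Q.* φ c) ≡ 0ℚ
    vanish c = trans (cong (λ a → φ c Q.* (a Q.- θ Q.* φ c)) (eigen c))
      (trans (cong (φ c Q.*_) (QP.+-inverseʳ (θ Q.* φ c))) (QP.*-zeroʳ (φ c)))

module DistanceRegular {n : ℕ} (G : Graph n) (d : ℕ) (a b c : ℕ → ℕ) (drg : IsDRG G d a b c) where
  open Distance G
  open IsDRG drg

  dist-≤-diameter : ∀ i {x y} → distIs G i x y ≡ true → i ≤ d
  dist-≤-diameter zero _ = z≤n
  dist-≤-diameter (suc i) {x} {y} h with ℕP.≤-<-connex (suc i) d
  ... | inj₁ i<d = i<d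
  ... | inj₂ (s≤s d≤i) = ⊥-elim (true≢false (within-mono d≤i (connected-diam x y)) (dist⇒¬within i h))

  dist : Fin n → Fin n → ℕ
  dist x y = least (λ i → within G i x y) d

  dist-correct : ∀ x y → distIs G (dist x y) x y ≡ true
  dist-correct x y = dist-least (dist x y) (least-sound (λ i → within G i x y) d (connected-diam x y))
    (least-minimal (λ i → within G i x y) d)

  dist-≡ : ∀ j {x y} → distIs G j x y ≡ true → dist x y ≡ j
  dist-≡ j {x} {y} h = dist-unique _ j (dist-correct x y) h

  positive-distance : ∀ x y → ¬ (x ≡ y) → ∃ λ i → distIs G (suc i) x y ≡ true
  positive-distance x y x≢y with dist x y | dist-correct x y
  ... | zero | h = ⊥-elim (x≢y (within-0⁻ h))
  ... | suc i | h = i , h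

  p₀ : Fin n
  p₀ = proj₁ diam-attained

  layer : ∀ i → i ≤ d → ∃ λ w → distIs G i p₀ w ≡ true
  layer = dist-shorter d (proj₂ (proj₂ diam-attained))

  c-positive : ∀ i → suc i ≤ d → 1 ≤ c (suc i)
  c-positive i i<d with layer (suc i) i<d
  ... | w , hw with dist-last-step i hw
  ...   | u , w~u , hu = subst (1 ≤_) (c-prop (suc i) (s≤s z≤n) i<d p₀ w hw)
                           (count-positive _ u (∧-true w~u hu))

  b-positive : ∀ i → suc i ≤ d → 1 ≤ b i
  b-positive i i<d with layer (suc i) i<d
  ... | w , hw with dist-last-step i hw
  ...   | u , w~u , hu = subst (1 ≤_) (b-prop i (ℕP.≤-trans (ℕP.n≤1+n i) i<d) p₀ u hu)
                           (count-positive _ w (∧-true (adj-flip w~u) hw))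

  regular : ∀ u → count (adj G u) ≡ b 0
  regular u = trans (count-cong (λ w → trans (sym (∧-idem (adj G u w))) (cong (adj G u w ∧_) (sym (dist-1≡adj u w)))))
                    (b-prop 0 z≤n u u (within-refl u))

  -- Spherical functions.  Given any θ-eigenvector g (not identically zero), the
  -- standard sequence α_i of θ makes u ↦ α_{dist(v,u)} a θ-eigenvector for every v.
  module Spherical (θ : ℚ) (g : Fin n → ℚ) (v₀ : Fin n) (g-v₀ : ¬ (g v₀ ≡ 0ℚ))
                   (g-eigen : ∀ x → applyA G g x ≡ θ Q.* g x) where

    -- α↓ j = α_{d+1-j}: starting from α_{d+1} = 0 and α_d = 1, the relation
    -- c_i α_{i-1} + a_i α_i + b_i α_{i+1} = θ α_i is solved for α_{i-1}.
    α↓ : ℕ → ℚ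
    α↓ zero = 0ℚ
    α↓ (suc zero) = 1ℚ
    α↓ (suc (suc j)) = ((θ Q.- ℕtoℚ (a (d ∸ j))) Q.* α↓ (suc j) Q.- ℕtoℚ (b (d ∸ j)) Q.* α↓ j) ÷ℕ c (d ∸ j)

    α↓-step : ∀ j i → d ∸ j ≡ i → 1 ≤ c i →
      ℕtoℚ (c i) Q.* α↓ (suc (suc j)) ≡ (θ Q.- ℕtoℚ (a i)) Q.* α↓ (suc j) Q.- ℕtoℚ (b i) Q.* α↓ j
    α↓-step j .(d ∸ j) refl c≥1 = ÷ℕ-cancel _ (c (d ∸ j)) c≥1

    α : ℕ → ℚ
    α i = α↓ (suc d ∸ i)

    α-top : α d ≡ 1ℚ
    α-top = cong α↓ (trans (ℕP.+-∸-assoc 1 (ℕP.≤-refl {d})) (cong suc (ℕP.n∸n≡0 d)))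

    α-recurrence : ∀ i → suc i ≤ d →
      ℕtoℚ (c (suc i)) Q.* α i Q.+ ℕtoℚ (a (suc i)) Q.* α (suc i) Q.+ ℕtoℚ (b (suc i)) Q.* α (suc (suc i))
        ≡ θ Q.* α (suc i)
    α-recurrence i i<d = begin
      C Q.* α i Q.+ A Q.* α (suc i) Q.+ B Q.* α↓ j
        ≡⟨ cong₂ (λ x y → C Q.* x Q.+ A Q.* y Q.+ B Q.* α↓ j) (cong α↓ d+1-i) (cong α↓ d-i) ⟩
      C Q.* α↓ (suc (suc j)) Q.+ A Q.* α↓ (suc j) Q.+ B Q.* α↓ j
        ≡⟨ cong (λ z → z Q.+ A Q.* α↓ (suc j) Q.+ B Q.* α↓ j) (α↓-step j (suc i) (ℕP.m∸[m∸n]≡n i<d) (c-positive i i<d)) ⟩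
      (θ Q.- A) Q.* α↓ (suc j) Q.- B Q.* α↓ j Q.+ A Q.* α↓ (suc j) Q.+ B Q.* α↓ j
        ≡⟨ solve 5 (λ t x y z w → (t :- x) :* y :- z :* w :+ x :* y :+ z :* w := t :* y) refl θ A (α↓ (suc j)) B (α↓ j) ⟩
      θ Q.* α↓ (suc j)
        ≡⟨ cong (λ z → θ Q.* α↓ z) (sym d-i) ⟩
      θ Q.* α (suc i) ∎
      where
      open ≡-Reasoning
      j = d ∸ suc i
      C = ℕtoℚ (c (suc i))
      A = ℕtoℚ (a (suc i))
      B = ℕtoℚ (b (suc i))
      d-i : d ∸ i ≡ suc j
      d-i = ℕP.+-∸-assoc 1 i<d
      d+1-i : suc d ∸ i ≡ suc (suc j)
      d+1-i = trans (ℕP.+-∸-assoc 1 (ℕP.≤-trans (ℕP.n≤1+n i) i<d)) (cong suc d-i)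

    spherical : Fin n → Fin n → ℚ
    spherical v u = α (dist v u)

    neighbour-value : ∀ i {v t u} → distIs G (suc i) v t ≡ true → adj G t u ≡ true →
      α (dist v u) ≡ (if distIs G i v u then α i else 0ℚ)
                     Q.+ (if distIs G (suc i) v u then α (suc i) else 0ℚ)
                     Q.+ (if distIs G (suc (suc i)) v u then α (suc (suc i)) else 0ℚ)
    neighbour-value i {v} {t} {u} ht t~u with dist-neighbour i ht t~u
    ... | inj₁ h = trans (cong α (dist-≡ i h)) (sym (trans
      (cong₂ Q._+_ (cong₂ Q._+_ (if-true h) (if-false (dist-exclusive i (suc i) h λ ())))
                   (if-false (dist-exclusive i (suc (suc i)) h λ ())))
      (trans (QP.+-identityʳ _) (QP.+-identityʳ (α i)))))
    ... | inj₂ (inj₁ h) = trans (cong α (dist-≡ (suc i) h)) (sym (trans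
      (cong₂ Q._+_ (cong₂ Q._+_ (if-false (dist-exclusive (suc i) i h λ ())) (if-true h))
                   (if-false (dist-exclusive (suc i) (suc (suc i)) h λ ())))
      (trans (QP.+-identityʳ _) (QP.+-identityˡ (α (suc i))))))
    ... | inj₂ (inj₂ h) = trans (cong α (dist-≡ (suc (suc i)) h)) (sym (trans
      (cong₂ Q._+_ (cong₂ Q._+_ (if-false (dist-exclusive (suc (suc i)) i h λ ()))
                                (if-false (dist-exclusive (suc (suc i)) (suc i) h λ ()))) (if-true h))
      (QP.+-identityˡ (α (suc (suc i))))))

    -- Away from its centre, the spherical function satisfies A ω = θ ω: the
    -- neighbours of t split into c_{i+1}, a_{i+1}, b_{i+1} vertices at distance
    -- i, i+1, i+2 from v, and α satisfies the three-term recurrence.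
    spherical-off-centre : ∀ i v t → distIs G (suc i) v t ≡ true →
      applyA G (spherical v) t ≡ θ Q.* spherical v t
    spherical-off-centre i v t ht = begin
      sumℚ (λ u → if adj G t u then α (dist v u) else 0ℚ)
        ≡⟨ sumℚ-cong split ⟩
      sumℚ (λ u → X i u Q.+ X (suc i) u Q.+ X (suc (suc i)) u)
        ≡⟨ trans (sumℚ-+ (λ u → X i u Q.+ X (suc i) u) (X (suc (suc i))))
                 (cong (Q._+ sumℚ (X (suc (suc i)))) (sumℚ-+ (X i) (X (suc i)))) ⟩
      sumℚ (X i) Q.+ sumℚ (X (suc i)) Q.+ sumℚ (X (suc (suc i)))
        ≡⟨ cong₂ Q._+_ (cong₂ Q._+_ (layer-sum i) (layer-sum (suc i))) (layer-sum (suc (suc i))) ⟩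
      N i Q.* α i Q.+ N (suc i) Q.* α (suc i) Q.+ N (suc (suc i)) Q.* α (suc (suc i))
        ≡⟨ cong₂ (λ p q → ℕtoℚ p Q.* α i Q.+ ℕtoℚ q Q.* α (suc i) Q.+ N (suc (suc i)) Q.* α (suc (suc i)))
             (c-prop (suc i) (s≤s z≤n) i<d v t ht) (a-prop (suc i) i<d v t ht) ⟩
      ℕtoℚ (c (suc i)) Q.* α i Q.+ ℕtoℚ (a (suc i)) Q.* α (suc i) Q.+ N (suc (suc i)) Q.* α (suc (suc i))
        ≡⟨ cong (λ p → ℕtoℚ (c (suc i)) Q.* α i Q.+ ℕtoℚ (a (suc i)) Q.* α (suc i) Q.+ ℕtoℚ p Q.* α (suc (suc i)))
             (b-prop (suc i) i<d v t ht) ⟩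
      ℕtoℚ (c (suc i)) Q.* α i Q.+ ℕtoℚ (a (suc i)) Q.* α (suc i) Q.+ ℕtoℚ (b (suc i)) Q.* α (suc (suc i))
        ≡⟨ α-recurrence i i<d ⟩
      θ Q.* α (suc i)
        ≡⟨ cong (λ e → θ Q.* α e) (sym (dist-≡ (suc i) ht)) ⟩
      θ Q.* spherical v t ∎
      where
      open ≡-Reasoning
      i<d = dist-≤-diameter (suc i) ht
      at : ℕ → Fin n → Bool
      at j u = adj G t u ∧ distIs G j v u
      N : ℕ → ℚ
      N j = ℕtoℚ (count (at j))
      X : ℕ → Fin n → ℚ
      X j u = if at j u then α j else 0ℚ
      layer-sum : ∀ j → sumℚ (X j) ≡ N j Q.* α j
      layer-sum j = sumℚ-indicator (at j) (α j)
      split : ∀ u → (if adj G t u then α (dist v u) else 0ℚ) ≡ X i u Q.+ X (suc i) u Q.+ X (suc (suc i)) u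
      split u = bool-cases (adj G t u)
        (λ t~u → trans (if-true t~u) (trans (neighbour-value i ht t~u)
          (sym (cong (λ β → (if β ∧ distIs G i v u then α i else 0ℚ)
                         Q.+ (if β ∧ distIs G (suc i) v u then α (suc i) else 0ℚ)
                         Q.+ (if β ∧ distIs G (suc (suc i)) v u then α (suc (suc i)) else 0ℚ)) t~u))))
        (λ t≁u → trans (if-false t≁u)
          (sym (cong (λ β → (if β ∧ distIs G i v u then α i else 0ℚ)
                         Q.+ (if β ∧ distIs G (suc i) v u then α (suc i) else 0ℚ)
                         Q.+ (if β ∧ distIs G (suc (suc i)) v u then α (suc (suc i)) else 0ℚ)) t≁u)))

    spherical-centre : ∀ v → applyA G (spherical v) v ≡ ℕtoℚ (b 0) Q.* α 1
    spherical-centre v = begin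
      sumℚ (λ u → if adj G v u then α (dist v u) else 0ℚ)  ≡⟨ sumℚ-cong neighbours-at-1 ⟩
      sumℚ (λ u → if adj G v u then α 1 else 0ℚ)           ≡⟨ sumℚ-indicator (adj G v) (α 1) ⟩
      ℕtoℚ (count (adj G v)) Q.* α 1                        ≡⟨ cong (λ k → ℕtoℚ k Q.* α 1) (regular v) ⟩
      ℕtoℚ (b 0) Q.* α 1                                    ∎
      where
      open ≡-Reasoning
      neighbours-at-1 : ∀ u → (if adj G v u then α (dist v u) else 0ℚ) ≡ (if adj G v u then α 1 else 0ℚ)
      neighbours-at-1 u = bool-cases (adj G v u)
        (λ v~u → trans (if-true v~u) (trans (cong α (dist-≡ 1 (trans (dist-1≡adj v u) v~u))) (sym (if-true v~u))))
        (λ v≁u → trans (if-false v≁u) (sym (if-false v≁u)))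

    defect : ℚ
    defect = ℕtoℚ (b 0) Q.* α 1 Q.- θ Q.* α 0

    spherical-defect : ∀ v t →
      applyA G (spherical v) t ≡ θ Q.* spherical v t Q.+ (if ⌊ v ≟ t ⌋ then defect else 0ℚ)
    spherical-defect v t with v ≟ t
    ... | yes refl = trans (spherical-centre v)
      (trans (solve 4 (λ k x t y → k :* x := t :* y :+ (k :* x :- t :* y)) refl (ℕtoℚ (b 0)) (α 1) θ (α 0))
             (cong (λ e → θ Q.* α e Q.+ defect) (sym (dist-≡ 0 (within-refl v)))))
    ... | no v≢t with positive-distance v t v≢t
    ...   | i , h = trans (spherical-off-centre i v t h) (sym (QP.+-identityʳ _))

    -- Pairing A ω_{v₀} with the eigenvector g and using self-adjointness of A
    -- gives g(v₀)·defect = 0, so the defect vanishes.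
    defect-zero : defect ≡ 0ℚ
    defect-zero = *-zero-cancelˡ (g v₀) defect g-defect g-v₀
      where
      ω = spherical v₀
      P : ℚ
      P = sumℚ (λ t → g t Q.* (θ Q.* ω t))
      point : Fin n → ℚ
      point t = g t Q.* (if ⌊ v₀ ≟ t ⌋ then defect else 0ℚ)
      pairing₁ : sumℚ (λ t → g t Q.* applyA G ω t) ≡ P Q.+ g v₀ Q.* defect
      pairing₁ = trans (sumℚ-cong (λ t → trans (cong (g t Q.*_) (spherical-defect v₀ t)) (QP.*-distribˡ-+ (g t) _ _)))
        (trans (sumℚ-+ (λ t → g t Q.* (θ Q.* ω t)) point)
        (cong (P Q.+_) (trans (sumℚ-single point v₀ (λ t t≢v₀ →
            trans (cong (λ β → g t Q.* (if β then defect else 0ℚ)) (≟-false (λ v₀≡t → t≢v₀ (sym v₀≡t))))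
                  (QP.*-zeroʳ (g t))))
          (cong (λ β → g v₀ Q.* (if β then defect else 0ℚ)) (≟-refl v₀)))))
      pairing₂ : sumℚ (λ t → g t Q.* applyA G ω t) ≡ P
      pairing₂ = trans (applyA-self-adjoint G g ω) (sumℚ-cong (λ u →
        trans (cong (ω u Q.*_) (g-eigen u)) (solve 3 (λ w t x → w :* (t :* x) := x :* (t :* w)) refl (ω u) θ (g u))))
      g-defect : g v₀ Q.* defect ≡ 0ℚ
      g-defect = trans (solve 2 (λ p q → q := (p :+ q) :- p) refl P (g v₀ Q.* defect))
        (trans (cong (Q._- P) (trans (sym pairing₁) pairing₂)) (QP.+-inverseʳ P))

    spherical-eigen : ∀ v t → applyA G (spherical v) t ≡ θ Q.* spherical v t
    spherical-eigen v t = trans (spherical-defect v t)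
      (trans (cong (θ Q.* spherical v t Q.+_) (vanish ⌊ v ≟ t ⌋)) (QP.+-identityʳ _))
      where
      vanish : ∀ β → (if β then defect else 0ℚ) ≡ 0ℚ
      vanish true = defect-zero
      vanish false = refl

module Geometric {n m : ℕ} (G : Graph n) (d : ℕ) (a b c : ℕ → ℕ) (drg : IsDRG G d a b c) (d≥2 : 2 ≤ d)
  (θ : ℚ) (g : Fin n → ℚ) (v₀ : Fin n) (g-v₀ : ¬ (g v₀ ≡ 0ℚ)) (g-eigen : ∀ x → applyA G g x ≡ θ Q.* g x)
  (𝒞 : Fin m → Fin n → Bool) (geometry : IsDelsarteCliqueGeometry G (b 0) θ m 𝒞) where
  open Distance G
  open IsDRG drg
  open DistanceRegular G d a b c drg
  open Spherical θ g v₀ g-v₀ g-eigen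
  open DelsarteGeometry G (b 0) θ 𝒞 regular (b-positive 0 (ℕP.≤-trans (s≤s z≤n) d≥2)) geometry

  inside outside : Fin m → Fin n → ℕ
  inside j y = count (λ c → 𝒞 j c ∧ adj G y c)
  outside j y = count (λ c → 𝒞 j c ∧ not (adj G y c))

  clique-size : ∀ j y → ℕtoℚ (count (𝒞 j)) ≡ ℕtoℚ (inside j y) Q.+ ℕtoℚ (outside j y)
  clique-size j y = trans (cong ℕtoℚ (count-split (𝒞 j) (adj G y))) (ℕtoℚ-+ (inside j y) (outside j y))

  -- If y ∉ C_j has a neighbour c₀ ∈ C_j, every vertex of C_j is at distance 1 or
  -- 2 from y, so the vanishing of the clique sum of ω_y reads
  -- inside·α₁ + outside·α₂ = 0.
  clique-relation : ∀ j y c₀ → 𝒞 j y ≡ false → 𝒞 j c₀ ≡ true → adj G y c₀ ≡ true →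
    ℕtoℚ (inside j y) Q.* α 1 Q.+ ℕtoℚ (outside j y) Q.* α 2 ≡ 0ℚ
  clique-relation j y c₀ y∉C c₀∈C y~c₀ = begin
    ℕtoℚ (inside j y) Q.* α 1 Q.+ ℕtoℚ (outside j y) Q.* α 2
      ≡⟨ sym (cong₂ Q._+_ (sumℚ-indicator (λ c → 𝒞 j c ∧ adj G y c) (α 1))
                          (sumℚ-indicator (λ c → 𝒞 j c ∧ not (adj G y c)) (α 2))) ⟩
    sumℚ near Q.+ sumℚ far   ≡⟨ sym (sumℚ-+ near far) ⟩
    sumℚ (λ c → near c Q.+ far c)   ≡⟨ sumℚ-cong (λ c → sym (by-distance c)) ⟩
    clique-sum (spherical y) j   ≡⟨ eigenvector-clique-sum (spherical y) (spherical-eigen y) j ⟩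
    0ℚ ∎
    where
    open ≡-Reasoning
    near far : Fin n → ℚ
    near c = if 𝒞 j c ∧ adj G y c then α 1 else 0ℚ
    far c = if 𝒞 j c ∧ not (adj G y c) then α 2 else 0ℚ
    by-distance : ∀ c → (if 𝒞 j c then α (dist y c) else 0ℚ) ≡ near c Q.+ far c
    by-distance c with 𝒞 j c in c∈C | adj G y c in y~c
    ... | false | _ = sym (QP.+-identityˡ 0ℚ)
    ... | true | true = trans (cong α (dist-≡ 1 (trans (dist-1≡adj y c) y~c))) (sym (QP.+-identityʳ (α 1)))
    ... | true | false = trans (cong α (dist-≡ 2 (dist-2-intro y≢c y~c y~c₀ c₀~c))) (sym (QP.+-identityˡ (α 2)))
      where
      y≢c : ¬ (y ≡ c)
      y≢c refl = true≢false c∈C y∉C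
      c₀~c : adj G c₀ c ≡ true
      c₀~c = is-clique j c₀ c c₀∈C c∈C (λ c₀≡c → true≢false (subst (λ z → adj G y z ≡ true) c₀≡c y~c₀) y~c)

  -- Two consecutive vanishing values α_{l+1} = α_{l+2} = 0 propagate upwards
  -- through the recurrence, since b_{l+2} ≠ 0 below the diameter.
  α-zeros-propagate : α 1 ≡ 0ℚ → α 2 ≡ 0ℚ → ∀ l → suc (suc l) ≤ d →
    α (suc l) ≡ 0ℚ × α (suc (suc l)) ≡ 0ℚ
  α-zeros-propagate α₁≡0 α₂≡0 zero _ = α₁≡0 , α₂≡0
  α-zeros-propagate α₁≡0 α₂≡0 (suc l) l+3≤d with α-zeros-propagate α₁≡0 α₂≡0 l (ℕP.≤-trans (ℕP.n≤1+n _) l+3≤d)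
  ... | α-l+1 , α-l+2 = α-l+2 , *-zero-cancelˡ B (α (3 ℕ.+ l)) Bα
      (ℕtoℚ-positive (b-positive (suc (suc l)) l+3≤d))
    where
    C = ℕtoℚ (c (suc (suc l)))
    A = ℕtoℚ (a (suc (suc l)))
    B = ℕtoℚ (b (suc (suc l)))
    Bα : B Q.* α (3 ℕ.+ l) ≡ 0ℚ
    Bα = begin
      B Q.* α (3 ℕ.+ l)
        ≡⟨ solve 5 (λ c x a y z → z := c :* x :+ a :* y :+ z :- (c :* x :+ a :* y)) refl
             C (α (suc l)) A (α (suc (suc l))) (B Q.* α (3 ℕ.+ l)) ⟩
      C Q.* α (suc l) Q.+ A Q.* α (suc (suc l)) Q.+ B Q.* α (3 ℕ.+ l) Q.- (C Q.* α (suc l) Q.+ A Q.* α (suc (suc l)))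
        ≡⟨ cong (Q._- (C Q.* α (suc l) Q.+ A Q.* α (suc (suc l)))) (α-recurrence (suc l) (ℕP.≤-trans (ℕP.n≤1+n _) l+3≤d)) ⟩
      θ Q.* α (suc (suc l)) Q.- (C Q.* α (suc l) Q.+ A Q.* α (suc (suc l)))
        ≡⟨ cong₂ (λ p q → θ Q.* q Q.- (C Q.* p Q.+ A Q.* q)) α-l+1 α-l+2 ⟩
      θ Q.* 0ℚ Q.- (C Q.* 0ℚ Q.+ A Q.* 0ℚ)
        ≡⟨ solve 3 (λ t c a → t :* con 0ℚ :- (c :* con 0ℚ :+ a :* con 0ℚ) := con 0ℚ) refl θ C A ⟩
      0ℚ ∎
      where open ≡-Reasoning

  -- α₁ ≠ α₂ as soon as some vertex is at distance 1 from a clique of 𝒞: if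
  -- α₁ = α₂, the clique relation gives |C|·α₂ = 0, so α₁ = α₂ = 0 and then
  -- α_d = 0, contradicting α_d = 1.
  α₁≢α₂ : ∀ j y c₀ → 𝒞 j y ≡ false → 𝒞 j c₀ ≡ true → adj G y c₀ ≡ true → ¬ (α 1 ≡ α 2)
  α₁≢α₂ j y c₀ y∉C c₀∈C y~c₀ α₁≡α₂ = QP.1≢0 (trans (sym α-top) α-d≡0)
    where
    size-α₂ : ℕtoℚ (count (𝒞 j)) Q.* α 2 ≡ 0ℚ
    size-α₂ = trans (cong (Q._* α 2) (clique-size j y))
      (trans (QP.*-distribʳ-+ (α 2) (ℕtoℚ (inside j y)) (ℕtoℚ (outside j y)))
      (trans (cong (λ z → ℕtoℚ (inside j y) Q.* z Q.+ ℕtoℚ (outside j y) Q.* α 2) (sym α₁≡α₂))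
             (clique-relation j y c₀ y∉C c₀∈C y~c₀)))
    α₂≡0 : α 2 ≡ 0ℚ
    α₂≡0 = *-zero-cancelˡ _ (α 2) size-α₂ (ℕtoℚ-positive (count-positive (𝒞 j) c₀ c₀∈C))
    l = proj₁ (ℕP.m≤n⇒∃[o]m+o≡n d≥2)
    d≡l+2 : 2 ℕ.+ l ≡ d
    d≡l+2 = proj₂ (ℕP.m≤n⇒∃[o]m+o≡n d≥2)
    α-d≡0 : α d ≡ 0ℚ
    α-d≡0 = subst (λ e → α e ≡ 0ℚ) d≡l+2
      (proj₂ (α-zeros-propagate (trans α₁≡α₂ α₂≡0) α₂≡0 l (ℕP.≤-reflexive d≡l+2)))

  -- ψ₁ is well defined: all vertices at distance 1 from C_j have the same
  -- number of neighbours in C_j, namely the unique solution P of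
  -- P·α₁ + (|C_j| - P)·α₂ = 0.
  ψ₁-constant : ∀ j y z c₀ c₁ → 𝒞 j y ≡ false → 𝒞 j z ≡ false →
    𝒞 j c₀ ≡ true → adj G y c₀ ≡ true → 𝒞 j c₁ ≡ true → adj G z c₁ ≡ true →
    inside j y ≡ inside j z
  ψ₁-constant j y z c₀ c₁ y∉C z∉C c₀∈C y~c₀ c₁∈C z~c₁ = ℕtoℚ-injective
    (coefficient-unique _ _ _ _ (α 1) (α 2) (trans (sym (clique-size j y)) (clique-size j z))
      (clique-relation j y c₀ y∉C c₀∈C y~c₀) (clique-relation j z c₁ z∉C c₁∈C z~c₁)
      (α₁≢α₂ j y c₀ y∉C c₀∈C y~c₀))

  open CliqueGeometry G 𝒞 is-clique edge-in-one using (clique-through; same-clique)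

  CommonNeighboursAdjacent : Fin n → Fin n → Set
  CommonNeighboursAdjacent x y = ∀ u w → adj G x u ≡ true → adj G y u ≡ true →
    adj G x w ≡ true → adj G y w ≡ true → ¬ (u ≡ w) → adj G u w ≡ true

  -- Let dist(x,y) = 2 with pairwise adjacent common neighbours, and let C_j
  -- contain x and a common neighbour u₁.  Then C_j contains every common
  -- neighbour w: otherwise y and w are both at distance 1 from C_j, every
  -- neighbour of y in C_j is a neighbour of w, and x is a neighbour of w but not
  -- of y — so w has more neighbours in C_j than y, contradicting ψ₁-constant.
  common-neighbours-in-clique : ∀ x y u₁ j → distIs G 2 x y ≡ true → CommonNeighboursAdjacent x y →
    adj G y u₁ ≡ true → 𝒞 j x ≡ true → 𝒞 j u₁ ≡ true →
    ∀ w → adj G x w ≡ true → adj G y w ≡ true → 𝒞 j w ≡ true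
  common-neighbours-in-clique x y u₁ j xy-2 adjacent y~u₁ x∈C u₁∈C w x~w y~w = ¬false⇒true λ w∉C →
    ℕP.<-irrefl (ψ₁-constant j y w u₁ x y∉C w∉C u₁∈C y~u₁ x∈C (adj-flip x~w))
      (count-mono-< _ _ (y-neighbour⇒w-neighbour w∉C) x
        (trans (cong (𝒞 j x ∧_) (adj-flip x≁y)) (∧-zeroʳ (𝒞 j x)))
        (∧-true x∈C (adj-flip x~w)))
    where
    x≁y : adj G x y ≡ false
    x≁y = dist-2-nonadj xy-2
    y∉C : 𝒞 j y ≡ false
    y∉C = ¬true⇒false λ y∈C → true≢false (is-clique j x y x∈C y∈C (dist-2-≢ xy-2)) x≁y
    y-neighbour⇒w-neighbour : 𝒞 j w ≡ false → ∀ c → (𝒞 j c ∧ adj G y c) ≡ true → (𝒞 j c ∧ adj G w c) ≡ true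
    y-neighbour⇒w-neighbour w∉C c h with ∧-true⁻ {𝒞 j c} h
    ... | c∈C , y~c = ∧-true c∈C (adj-flip (adjacent c w x~c y~c x~w y~w c≢w))
      where
      x~c : adj G x c ≡ true
      x~c = is-clique j x c x∈C c∈C (λ x≡c → true≢false (subst (λ z → adj G y z ≡ true) (sym x≡c) y~c) (adj-flip x≁y))
      c≢w : ¬ (c ≡ w)
      c≢w c≡w = true≢false (subst (λ z → 𝒞 j z ≡ true) c≡w c∈C) w∉C

  quadrangle-test : Fin n → Fin n → Fin n → Fin n → Bool
  quadrangle-test x y u w =
    (adj G x u ∧ adj G y u) ∧ ((adj G x w ∧ adj G y w) ∧ (not ⌊ u ≟ w ⌋ ∧ not (adj G u w)))

  quadrangle-or-adjacent : ∀ x y → distIs G 2 x y ≡ true → HasInducedK G 2 2 ⊎ CommonNeighboursAdjacent x y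
  quadrangle-or-adjacent x y xy-2 with search-pairs (quadrangle-test x y)
  ... | inj₁ (u , w , h) with ∧-true⁻ {adj G x u ∧ adj G y u} h
  ...   | u-common , h' with ∧-true⁻ {adj G x w ∧ adj G y w} h'
  ...     | w-common , h'' with ∧-true⁻ {not ⌊ u ≟ w ⌋} h''
  ...       | u≢w , u≁w = inj₁ (InducedK.induced-quadrangle G x y u w (dist-2-≢ xy-2) (dist-2-nonadj xy-2)
      (λ u≡w → true≢false (subst (λ z → ⌊ u ≟ z ⌋ ≡ true) u≡w (≟-refl u)) (not-true⁻ u≢w)) (not-true⁻ u≁w)
      (proj₁ (∧-true⁻ u-common)) (proj₂ (∧-true⁻ {adj G x u} u-common))
      (proj₁ (∧-true⁻ w-common)) (proj₂ (∧-true⁻ {adj G x w} w-common)))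
  quadrangle-or-adjacent x y xy-2 | inj₂ none = inj₂ λ u w x~u y~u x~w y~w u≢w → ¬false⇒true λ u≁w →
    true≢false (∧-true (∧-true x~u y~u) (∧-true (∧-true x~w y~w) (∧-true (not-true (≟-false u≢w)) (not-true u≁w))))
               (none u w)

  -- Take x, y at distance 2 with common neighbours
  -- u₁ ≠ u₂ (μ ≥ 2).  Without an induced quadrangle, the clique through x, u₁ and
  -- the clique through y, u₁ both contain u₁ and u₂, hence coincide; then x ~ y.
  quadrangle-at : ∀ x y → distIs G 2 x y ≡ true → 2 ≤ c 2 → HasInducedK G 2 2
  quadrangle-at x y xy-2 μ≥2 with quadrangle-or-adjacent x y xy-2
  ... | inj₁ quadrangle = quadrangle
  ... | inj₂ adjacent = ⊥-elim (true≢false (is-clique jx x y x∈Cx y∈Cx (dist-2-≢ xy-2)) (dist-2-nonadj xy-2))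
    where
    common : Fin n → Bool
    common u = adj G y u ∧ distIs G 1 x u
    two-common = two-witnesses common (subst (2 ≤_) (sym (c-prop 2 (s≤s z≤n) d≥2 x y xy-2)) μ≥2)
    u₁ = proj₁ two-common
    u₂ = proj₁ (proj₂ two-common)
    u₁≢u₂ = proj₁ (proj₂ (proj₂ two-common))
    y~u₁ = proj₁ (∧-true⁻ (proj₁ (proj₂ (proj₂ (proj₂ two-common)))))
    x~u₁ = trans (sym (dist-1≡adj x u₁)) (proj₂ (∧-true⁻ {adj G y u₁} (proj₁ (proj₂ (proj₂ (proj₂ two-common))))))
    y~u₂ = proj₁ (∧-true⁻ (proj₂ (proj₂ (proj₂ (proj₂ two-common)))))
    x~u₂ = trans (sym (dist-1≡adj x u₂)) (proj₂ (∧-true⁻ {adj G y u₂} (proj₂ (proj₂ (proj₂ (proj₂ two-common))))))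
    Cx = clique-through x u₁ x~u₁
    Cy = clique-through y u₁ y~u₁
    jx = proj₁ Cx
    jy = proj₁ Cy
    x∈Cx = proj₁ (proj₂ Cx)
    y∈Cy = proj₁ (proj₂ Cy)
    in-Cx : ∀ w → adj G x w ≡ true → adj G y w ≡ true → 𝒞 jx w ≡ true
    in-Cx = common-neighbours-in-clique x y u₁ jx xy-2 adjacent y~u₁ x∈Cx (proj₂ (proj₂ Cx))
    in-Cy : ∀ w → adj G x w ≡ true → adj G y w ≡ true → 𝒞 jy w ≡ true
    in-Cy w x~w y~w = common-neighbours-in-clique y x u₁ jy (dist-sym 2 {x} {y} xy-2)
      (λ u w y~u x~u y~w x~w → adjacent u w x~u y~u x~w y~w) x~u₁ y∈Cy (proj₂ (proj₂ Cy)) w y~w x~w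
    jx≡jy : jx ≡ jy
    jx≡jy = same-clique (adjacent u₁ u₂ x~u₁ y~u₁ x~u₂ y~u₂ u₁≢u₂)
      (in-Cx u₁ x~u₁ y~u₁) (in-Cx u₂ x~u₂ y~u₂) (in-Cy u₁ x~u₁ y~u₁) (in-Cy u₂ x~u₂ y~u₂)
    y∈Cx : 𝒞 jx y ≡ true
    y∈Cx = subst (λ j → 𝒞 j y ≡ true) (sym jx≡jy) y∈Cy

  μ≥2⇒quadrangle : 2 ≤ c 2 → HasInducedK G 2 2
  μ≥2⇒quadrangle = quadrangle-at p₀ (proj₁ (layer 2 d≥2)) (proj₂ (layer 2 d≥2))

-- Lemma 3.10.
lemma3p10 : ∀ {n : ℕ} (G : Graph n) (d : ℕ) (a b c : ℕ → ℕ) →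
    IsDRG G d a b c → 2 ≤ d →
    (θ : ℚ) → IsSmallestEigenvalue G θ →
    (m : ℕ) (𝒞 : Fin m → Fin n → Bool) → IsDelsarteCliqueGeometry G (b 0) θ m 𝒞 →
    (Psi1IsOne G 𝒞 →
       ∀ x y → distIs G 2 x y ≡ true → HasInducedK G (tauAt G 𝒞 2 x y) 2)
    × (2 ≤ c 2 → HasInducedK G 2 2)
lemma3p10 G d a b c drg d≥2 θ ((g , (v₀ , g-v₀) , g-eigen) , _) m 𝒞 geometry =
  (λ ψ₁-one x y xy-2 → ψ₁≡1.induced-K-τ₂-2 ψ₁-one x y xy-2) ,
  Geometric.μ≥2⇒quadrangle G d a b c drg d≥2 θ g v₀ g-v₀ g-eigen 𝒞 geometry
  where
  open CliqueGeometry G 𝒞 (λ j → proj₁ (proj₁ geometry j)) (proj₂ geometry)
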